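{- Let $\mathcal{C}$ be a finite biproduct category with idempotent convolution. Then $(\mathcal{C},\oplus,0)$ admits a trace making $\mathcal{C}$ a Kleene bicategory if and only if $\mathcal{C}$, regarded as a category enriched over join-semilattices via the convolution $+$, has a Kleene star operator.
   Context: Composition is diagrammatic. A finite biproduct category: symmetric monoidal $(\mathcal{C},\oplus,0)$ where each $X$ has a commutative monoid $(\nabla_X\colon X\oplus X\to X,¡_X\colon0\to X)$ and cocommutative comonoid $(\Delta_X\colon X\to X\oplus X,!_X\colon X\to 0)$, coherent with $\oplus$, every morphism being a monoid and comonoid homomorphism. Idempotent convolution: $\mathcal{C}$ is poset-enriched and $\mathrm{id}_{X\oplus X}\le\nabla_X;\Delta_X$, $\Delta_X;\nabla_X\le\mathrm{id}_X$, $\mathrm{id}_0\le¡_X;!_X$, $!_X;¡_X\le\mathrm{id}_X$. The convolution is $f+g:=\Delta_X;(f\oplus g);\nabla_Y$ with unit $0:=!_X;¡_Y$; then each homset is a join-semilattice with join $+$ and bottom $0$, whose order is the given one, and composition distributes over it. A Kleene bicategory is such a $\mathcal{C}$ with a trace $\mathsf{tr}_S\colon\mathcal{C}(S\oplus X,S\oplus Y)\to\mathcal{C}(X,Y)$ (satisfying tightening, strength, joining, vanishing, sliding, yanking) such that: (AU1) for $f\colon S\oplus X\to S\oplus Y$, $g\colon T\oplus X\to T\oplus Y$, if some $r\colon S\to T$ has $f;(r\oplus\mathrm{id}_Y)\le(r\oplus\mathrm{id}_X);g$ then $\mathsf{tr}_Sf\le\mathsf{tr}_Tg$; (AU2) if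 some $r\colon T\to S$ has $(r\oplus\mathrm{id}_X);f\le g;(r\oplus\mathrm{id}_Y)$ then $\mathsf{tr}_Sf\le\mathsf{tr}_Tg$; (AT1) $\mathsf{tr}_X(\nabla_X;\Delta_X)\le\mathrm{id}_X$. A Kleene star operator is a family $(\cdot)^*\colon\mathcal{C}(X,X)\to\mathcal{C}(X,X)$ such that for all $f\colon X\to X$, $r\colon X\to Y$, $l\colon Y\to X$: $\mathrm{id}_X+f;f^*\le f^*$; $\mathrm{id}_X+f^*;f\le f^*$; $f;r\le r$ implies $f^*;r\le r$; $l;f\le l$ implies $l;f^*\le l$. -}

module Defs where

open import Level using (Level; _⊔_) renaming (suc to lsuc)
open import Relation.Binary.Core using (Rel)
open import Relation.Binary.Structures using (IsPartialOrder)

-- Poset-enriched symmetric monoidal category (composition diagrammatic: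
-- f ⨾ g means "first f, then g").

record SymMonPosCat (o ℓ e r : Level) : Set (lsuc (o ⊔ ℓ ⊔ e ⊔ r)) where
  infixr 9 _⨾_
  infixr 10 _⊕_ _⊕₁_
  infix 4 _≈_ _≤_ _⇒_
  field
    Obj  : Set o
    _⇒_  : Obj → Obj → Set ℓ
    _≈_  : ∀ {A B} → Rel (A ⇒ B) e
    _≤_  : ∀ {A B} → Rel (A ⇒ B) r
    isPartialOrder : ∀ {A B} → IsPartialOrder (_≈_ {A} {B}) (_≤_ {A} {B})

    id   : ∀ {A} → A ⇒ A
    _⨾_  : ∀ {A B C} → A ⇒ B → B ⇒ C → A ⇒ C
    ⨾-assoc     : ∀ {A B C D} {f : A ⇒ B} {g : B ⇒ C} {h : C ⇒ D} →
                  (f ⨾ g) ⨾ h ≈ f ⨾ (g ⨾ h)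
    ⨾-identityˡ : ∀ {A B} {f : A ⇒ B} → id ⨾ f ≈ f
    ⨾-identityʳ : ∀ {A B} {f : A ⇒ B} → f ⨾ id ≈ f
    ⨾-mono      : ∀ {A B C} {f f′ : A ⇒ B} {g g′ : B ⇒ C} →
                  f ≤ f′ → g ≤ g′ → f ⨾ g ≤ f′ ⨾ g′

    _⊕_  : Obj → Obj → Obj
    _⊕₁_ : ∀ {A B C D} → A ⇒ B → C ⇒ D → A ⊕ C ⇒ B ⊕ D
    𝟎    : Obj
    ⊕-identity : ∀ {A B} → id {A} ⊕₁ id {B} ≈ id
    ⊕-homo     : ∀ {A B C D E F} {f : A ⇒ B} {g : B ⇒ C} {h : D ⇒ E} {k : E ⇒ F} →
                 (f ⨾ g) ⊕₁ (h ⨾ k) ≈ (f ⊕₁ h) ⨾ (g ⊕₁ k)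
    ⊕-mono     : ∀ {A B C D} {f f′ : A ⇒ B} {g g′ : C ⇒ D} →
                 f ≤ f′ → g ≤ g′ → f ⊕₁ g ≤ f′ ⊕₁ g′

    α⇒ : ∀ {A B C} → (A ⊕ B) ⊕ C ⇒ A ⊕ (B ⊕ C)
    α⇐ : ∀ {A B C} → A ⊕ (B ⊕ C) ⇒ (A ⊕ B) ⊕ C
    λ⇒ : ∀ {A} → 𝟎 ⊕ A ⇒ A
    λ⇐ : ∀ {A} → A ⇒ 𝟎 ⊕ A
    ρ⇒ : ∀ {A} → A ⊕ 𝟎 ⇒ A
    ρ⇐ : ∀ {A} → A ⇒ A ⊕ 𝟎
    σ  : ∀ {A B} → A ⊕ B ⇒ B ⊕ A

    α-isoˡ : ∀ {A B C} → α⇒ {A} {B} {C} ⨾ α⇐ {A} {B} {C} ≈ id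
    α-isoʳ : ∀ {A B C} → α⇐ {A} {B} {C} ⨾ α⇒ {A} {B} {C} ≈ id
    λ-isoˡ : ∀ {A} → λ⇒ {A} ⨾ λ⇐ {A} ≈ id
    λ-isoʳ : ∀ {A} → λ⇐ {A} ⨾ λ⇒ {A} ≈ id
    ρ-isoˡ : ∀ {A} → ρ⇒ {A} ⨾ ρ⇐ {A} ≈ id
    ρ-isoʳ : ∀ {A} → ρ⇐ {A} ⨾ ρ⇒ {A} ≈ id

    α-natural : ∀ {A A′ B B′ C C′} {f : A ⇒ A′} {g : B ⇒ B′} {h : C ⇒ C′} →
                ((f ⊕₁ g) ⊕₁ h) ⨾ α⇒ ≈ α⇒ ⨾ (f ⊕₁ (g ⊕₁ h))
    λ-natural : ∀ {A B} {f : A ⇒ B} → (id {𝟎} ⊕₁ f) ⨾ λ⇒ ≈ λ⇒ ⨾ f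
    ρ-natural : ∀ {A B} {f : A ⇒ B} → (f ⊕₁ id {𝟎}) ⨾ ρ⇒ ≈ ρ⇒ ⨾ f
    σ-natural : ∀ {A A′ B B′} {f : A ⇒ A′} {g : B ⇒ B′} →
                (f ⊕₁ g) ⨾ σ ≈ σ ⨾ (g ⊕₁ f)

    pentagon : ∀ {A B C D} →
               (α⇒ {A} {B} {C} ⊕₁ id {D}) ⨾ α⇒ {A} {B ⊕ C} {D} ⨾ (id {A} ⊕₁ α⇒ {B} {C} {D})
                 ≈ α⇒ {A ⊕ B} {C} {D} ⨾ α⇒ {A} {B} {C ⊕ D}
    triangle : ∀ {A B} → α⇒ {A} {𝟎} {B} ⨾ (id {A} ⊕₁ λ⇒ {B}) ≈ ρ⇒ {A} ⊕₁ id {B}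
    hexagon  : ∀ {A B C} →
               α⇒ {A} {B} {C} ⨾ σ {A} {B ⊕ C} ⨾ α⇒ {B} {C} {A}
                 ≈ (σ {A} {B} ⊕₁ id {C}) ⨾ α⇒ {B} {A} {C} ⨾ (id {B} ⊕₁ σ {A} {C})
    symmetry : ∀ {A B} → σ {A} {B} ⨾ σ {B} {A} ≈ id

module _ {o ℓ e r} (𝒞 : SymMonPosCat o ℓ e r) where
  open SymMonPosCat 𝒞

  τ : ∀ {A B C D} → (A ⊕ B) ⊕ (C ⊕ D) ⇒ (A ⊕ C) ⊕ (B ⊕ D)
  τ {A} {B} {C} {D} =
    α⇒ {A} {B} {C ⊕ D}
    ⨾ (id {A} ⊕₁ (α⇐ {B} {C} {D} ⨾ (σ {B} {C} ⊕₁ id {D}) ⨾ α⇒ {C} {B} {D}))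
    ⨾ α⇐ {A} {C} {B ⊕ D}

record FinBiprodIdemConv {o ℓ e r} (𝒞 : SymMonPosCat o ℓ e r)
       : Set (o ⊔ ℓ ⊔ e ⊔ r) where
  open SymMonPosCat 𝒞
  field
    ∇ : ∀ {X} → X ⊕ X ⇒ X
    ¡ : ∀ {X} → 𝟎 ⇒ X
    Δ : ∀ {X} → X ⇒ X ⊕ X
    ! : ∀ {X} → X ⇒ 𝟎

    ∇-assoc : ∀ {X} → (∇ {X} ⊕₁ id {X}) ⨾ ∇ {X}
                        ≈ α⇒ {X} {X} {X} ⨾ (id {X} ⊕₁ ∇ {X}) ⨾ ∇ {X}
    ∇-unit  : ∀ {X} → (¡ {X} ⊕₁ id {X}) ⨾ ∇ {X} ≈ λ⇒ {X}
    ∇-comm  : ∀ {X} → σ {X} {X} ⨾ ∇ {X} ≈ ∇ {X}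
    Δ-coassoc : ∀ {X} → Δ {X} ⨾ (Δ {X} ⊕₁ id {X}) ⨾ α⇒ {X} {X} {X}
                          ≈ Δ {X} ⨾ (id {X} ⊕₁ Δ {X})
    Δ-counit  : ∀ {X} → Δ {X} ⨾ (! {X} ⊕₁ id {X}) ≈ λ⇐ {X}
    Δ-cocomm  : ∀ {X} → Δ {X} ⨾ σ {X} {X} ≈ Δ {X}

    ∇-⊕ : ∀ {X Y} → ∇ {X ⊕ Y} ≈ τ 𝒞 {X} {Y} {X} {Y} ⨾ (∇ {X} ⊕₁ ∇ {Y})
    ¡-⊕ : ∀ {X Y} → ¡ {X ⊕ Y} ≈ λ⇐ {𝟎} ⨾ (¡ {X} ⊕₁ ¡ {Y})
    Δ-⊕ : ∀ {X Y} → Δ {X ⊕ Y} ≈ (Δ {X} ⊕₁ Δ {Y}) ⨾ τ 𝒞 {X} {X} {Y} {Y}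
    !-⊕ : ∀ {X Y} → ! {X ⊕ Y} ≈ (! {X} ⊕₁ ! {Y}) ⨾ λ⇒ {𝟎}
    ∇-𝟎 : ∇ {𝟎} ≈ λ⇒ {𝟎}
    ¡-𝟎 : ¡ {𝟎} ≈ id {𝟎}
    Δ-𝟎 : Δ {𝟎} ≈ λ⇐ {𝟎}
    !-𝟎 : ! {𝟎} ≈ id {𝟎}

    ∇-hom : ∀ {X Y} {f : X ⇒ Y} → ∇ {X} ⨾ f ≈ (f ⊕₁ f) ⨾ ∇ {Y}
    ¡-hom : ∀ {X Y} {f : X ⇒ Y} → ¡ {X} ⨾ f ≈ ¡ {Y}
    Δ-hom : ∀ {X Y} {f : X ⇒ Y} → f ⨾ Δ {Y} ≈ Δ {X} ⨾ (f ⊕₁ f)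
    !-hom : ∀ {X Y} {f : X ⇒ Y} → f ⨾ ! {Y} ≈ ! {X}

    -- idempotent convolution
    idem-⊕ : ∀ {X} → id {X ⊕ X} ≤ ∇ {X} ⨾ Δ {X}
    idem-X : ∀ {X} → Δ {X} ⨾ ∇ {X} ≤ id {X}
    idem-𝟎 : ∀ {X} → id {𝟎} ≤ ¡ {X} ⨾ ! {X}
    idem-! : ∀ {X} → ! {X} ⨾ ¡ {X} ≤ id {X}

  infixl 8 _+_
  _+_ : ∀ {X Y} → X ⇒ Y → X ⇒ Y → X ⇒ Y
  f + g = Δ ⨾ (f ⊕₁ g) ⨾ ∇

  0ₕ : ∀ {X Y} → X ⇒ Y
  0ₕ = ! ⨾ ¡

record KleeneBicategoryTrace {o ℓ e r} {𝒞 : SymMonPosCat o ℓ e r}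
       (B : FinBiprodIdemConv 𝒞) : Set (o ⊔ ℓ ⊔ e ⊔ r) where
  open SymMonPosCat 𝒞
  open FinBiprodIdemConv B
  field
    tr : ∀ {S X Y} → S ⊕ X ⇒ S ⊕ Y → X ⇒ Y
    tr-cong : ∀ {S X Y} {f g : S ⊕ X ⇒ S ⊕ Y} → f ≈ g → tr f ≈ tr g
    tightening : ∀ {S X X′ Y Y′} {f : S ⊕ X ⇒ S ⊕ Y} {g : X′ ⇒ X} {h : Y ⇒ Y′} →
                 tr ((id {S} ⊕₁ g) ⨾ f ⨾ (id {S} ⊕₁ h)) ≈ g ⨾ tr f ⨾ h
    strength : ∀ {S X Y Z} {f : S ⊕ X ⇒ S ⊕ Y} →
               tr {S} (α⇐ {S} {X} {Z} ⨾ (f ⊕₁ id {Z}) ⨾ α⇒ {S} {Y} {Z}) ≈ tr f ⊕₁ id {Z}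
    joining : ∀ {S T X Y} {f : (S ⊕ T) ⊕ X ⇒ (S ⊕ T) ⊕ Y} →
              tr {S ⊕ T} f ≈ tr {T} (tr {S} (α⇐ {S} {T} {X} ⨾ f ⨾ α⇒ {S} {T} {Y}))
    vanishing : ∀ {X Y} {f : 𝟎 ⊕ X ⇒ 𝟎 ⊕ Y} → tr {𝟎} f ≈ λ⇐ ⨾ f ⨾ λ⇒
    sliding : ∀ {S T X Y} {f : S ⊕ X ⇒ T ⊕ Y} {g : T ⇒ S} →
              tr {S} (f ⨾ (g ⊕₁ id {Y})) ≈ tr {T} ((g ⊕₁ id {X}) ⨾ f)
    yanking : ∀ {X} → tr {X} (σ {X} {X}) ≈ id {X}
    AU1 : ∀ {S T X Y} {f : S ⊕ X ⇒ S ⊕ Y} {g : T ⊕ X ⇒ T ⊕ Y} (r : S ⇒ T) →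
          f ⨾ (r ⊕₁ id {Y}) ≤ (r ⊕₁ id {X}) ⨾ g → tr f ≤ tr g
    AU2 : ∀ {S T X Y} {f : S ⊕ X ⇒ S ⊕ Y} {g : T ⊕ X ⇒ T ⊕ Y} (r : T ⇒ S) →
          (r ⊕₁ id {X}) ⨾ f ≤ g ⨾ (r ⊕₁ id {Y}) → tr f ≤ tr g
    AT1 : ∀ {X} → tr {X} (∇ {X} ⨾ Δ {X}) ≤ id {X}

record KleeneStar {o ℓ e r} {𝒞 : SymMonPosCat o ℓ e r}
       (B : FinBiprodIdemConv 𝒞) : Set (o ⊔ ℓ ⊔ e ⊔ r) where
  open SymMonPosCat 𝒞
  open FinBiprodIdemConv B
  field
    _* : ∀ {X} → X ⇒ X → X ⇒ X
    star-unfoldˡ : ∀ {X} {f : X ⇒ X} → id + f ⨾ (f *) ≤ f *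
    star-unfoldʳ : ∀ {X} {f : X ⇒ X} → id + (f *) ⨾ f ≤ f *
    star-indʳ : ∀ {X Y} {f : X ⇒ X} {r : X ⇒ Y} → f ⨾ r ≤ r → (f *) ⨾ r ≤ r
    star-indˡ : ∀ {X Y} {f : X ⇒ X} {l : Y ⇒ X} → l ⨾ f ≤ l → l ⨾ (f *) ≤ l

-- Read a morphism S ⊕ X ⇒ T ⊕ Y as the 2×2 matrix of its components [ f ]ᵢⱼ = ιᵢ ⨾ f ⨾ πⱼ.
-- A star gives the trace tr [[a, b], [c, d]] = d + c ⨾ a * ⨾ b (Conway's formula). Its axioms
-- become computations on components: AU1 and AU2 are the simulation rules of Kleene algebra,
-- AT1 is id * ≤ id, and joining is Conway's formula for the star of a 2×2 block matrix.
-- Conversely a trace gives a * = tr [[a, id], [id, 0]]. Tightening and strength force every trace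
-- to be d + c ⨾ a * ⨾ b for this star, so joining makes it satisfy the block formula; the unfolding
-- laws are read off the corners of the star of [[0, id], [x, 0]], and induction follows from AU1/AU2
-- (simulating along the bound r) together with AT1.
{-# OPTIONS --safe #-}
module Submission where

open import Defs
open import Level using (Level)
open import Function.Bundles using (_⇔_; mk⇔)
open import Relation.Binary.Bundles using (Poset)
open import Relation.Binary.Structures using (IsPartialOrder)
import Relation.Binary.Reasoning.PartialOrder as PosetReasoning

module Reasoning {o ℓ e r} (𝒞 : SymMonPosCat o ℓ e r) where
  open SymMonPosCat 𝒞 public

  private
    module PO {A B} = IsPartialOrder (isPartialOrder {A} {B})

  hom-poset : Obj → Obj → Poset _ _ _
  hom-poset A B = record { isPartialOrder = isPartialOrder {A} {B} }

  module HomReasoning {A B} = PosetReasoning (hom-poset A B)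
  open HomReasoning public using (begin_; begin-equality_; step-≤; step-≈-⟩; step-≈-⟨; _∎)

  infixr 4 _⟩⨾⟨_ _⟩⊕⟨_ refl⟩⨾⟨_ refl⟩⊕⟨_
  infixl 5 _⟩⨾⟨refl _⟩⊕⟨refl
  infixr 3 _○_ _○≤_

  private variable
    A B C D E F : Obj

  refl≈ : {f : A ⇒ B} → f ≈ f
  refl≈ = PO.Eq.refl

  sym≈ : {f g : A ⇒ B} → f ≈ g → g ≈ f
  sym≈ = PO.Eq.sym

  _○_ : {f g h : A ⇒ B} → f ≈ g → g ≈ h → f ≈ h
  _○_ = PO.Eq.trans

  ≤-refl : {f : A ⇒ B} → f ≤ f
  ≤-refl = PO.refl

  _○≤_ : {f g h : A ⇒ B} → f ≤ g → g ≤ h → f ≤ h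
  _○≤_ = PO.trans

  ≈⇒≤ : {f g : A ⇒ B} → f ≈ g → f ≤ g
  ≈⇒≤ = PO.reflexive

  ≈⇒≥ : {f g : A ⇒ B} → f ≈ g → g ≤ f
  ≈⇒≥ p = PO.reflexive (sym≈ p)

  ≤-antisym : {f g : A ⇒ B} → f ≤ g → g ≤ f → f ≈ g
  ≤-antisym = PO.antisym

  ⨾-monoˡ : {f f′ : A ⇒ B} {g : B ⇒ C} → f ≤ f′ → f ⨾ g ≤ f′ ⨾ g
  ⨾-monoˡ p = ⨾-mono p ≤-refl

  ⨾-monoʳ : {f : A ⇒ B} {g g′ : B ⇒ C} → g ≤ g′ → f ⨾ g ≤ f ⨾ g′
  ⨾-monoʳ p = ⨾-mono ≤-refl p

  _⟩⨾⟨_ : {f f′ : A ⇒ B} {g g′ : B ⇒ C} → f ≈ f′ → g ≈ g′ → f ⨾ g ≈ f′ ⨾ g′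
  p ⟩⨾⟨ q = ≤-antisym (⨾-mono (≈⇒≤ p) (≈⇒≤ q)) (⨾-mono (≈⇒≥ p) (≈⇒≥ q))

  refl⟩⨾⟨_ : {f : A ⇒ B} {g g′ : B ⇒ C} → g ≈ g′ → f ⨾ g ≈ f ⨾ g′
  refl⟩⨾⟨ q = refl≈ ⟩⨾⟨ q

  _⟩⨾⟨refl : {f f′ : A ⇒ B} {g : B ⇒ C} → f ≈ f′ → f ⨾ g ≈ f′ ⨾ g
  p ⟩⨾⟨refl = p ⟩⨾⟨ refl≈

  _⟩⊕⟨_ : {f f′ : A ⇒ B} {g g′ : C ⇒ D} → f ≈ f′ → g ≈ g′ → f ⊕₁ g ≈ f′ ⊕₁ g′
  p ⟩⊕⟨ q = ≤-antisym (⊕-mono (≈⇒≤ p) (≈⇒≤ q)) (⊕-mono (≈⇒≥ p) (≈⇒≥ q))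

  refl⟩⊕⟨_ : {f : A ⇒ B} {g g′ : C ⇒ D} → g ≈ g′ → f ⊕₁ g ≈ f ⊕₁ g′
  refl⟩⊕⟨ q = refl≈ ⟩⊕⟨ q

  _⟩⊕⟨refl : {f f′ : A ⇒ B} {g : C ⇒ D} → f ≈ f′ → f ⊕₁ g ≈ f′ ⊕₁ g
  p ⟩⊕⟨refl = p ⟩⊕⟨ refl≈

  assoc : {f : A ⇒ B} {g : B ⇒ C} {h : C ⇒ D} → (f ⨾ g) ⨾ h ≈ f ⨾ g ⨾ h
  assoc = ⨾-assoc

  sym-assoc : {f : A ⇒ B} {g : B ⇒ C} {h : C ⇒ D} → f ⨾ g ⨾ h ≈ (f ⨾ g) ⨾ h
  sym-assoc = sym≈ ⨾-assoc

  idˡ : {f : A ⇒ B} → id ⨾ f ≈ f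
  idˡ = ⨾-identityˡ

  idʳ : {f : A ⇒ B} → f ⨾ id ≈ f
  idʳ = ⨾-identityʳ

  pullˡ : {f : A ⇒ B} {g : B ⇒ C} {h : A ⇒ C} {k : C ⇒ D} → f ⨾ g ≈ h → f ⨾ g ⨾ k ≈ h ⨾ k
  pullˡ p = sym-assoc ○ p ⟩⨾⟨refl

  cancelˡ : {f : A ⇒ B} {g : B ⇒ A} {h : A ⇒ C} → f ⨾ g ≈ id → f ⨾ g ⨾ h ≈ h
  cancelˡ p = pullˡ p ○ idˡ

  elimˡ : {f : A ⇒ A} {h : A ⇒ C} → f ≈ id → f ⨾ h ≈ h
  elimˡ p = p ⟩⨾⟨refl ○ idˡ

  elimʳ : {f : A ⇒ C} {h : C ⇒ C} → h ≈ id → f ⨾ h ≈ f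
  elimʳ p = refl⟩⨾⟨ p ○ idʳ

  introˡ : {f : A ⇒ A} {h : A ⇒ C} → f ≈ id → h ≈ f ⨾ h
  introˡ p = sym≈ (elimˡ p)

  introʳ : {f : A ⇒ C} {h : C ⇒ C} → h ≈ id → f ≈ f ⨾ h
  introʳ p = sym≈ (elimʳ p)

  ⨾-sandwich : {u : A ⇒ B} {p : B ⇒ C} {k : C ⇒ D} {q : D ⇒ E} {v : E ⇒ F}
               {u′ : A ⇒ C} {v′ : D ⇒ F} →
               u ⨾ p ≈ u′ → q ⨾ v ≈ v′ → u ⨾ (p ⨾ k ⨾ q) ⨾ v ≈ u′ ⨾ k ⨾ v′
  ⨾-sandwich p q = refl⟩⨾⟨ assoc ○ pullˡ p ○ refl⟩⨾⟨ (assoc ○ refl⟩⨾⟨ q)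

  inner-mono : {f : A ⇒ B} {g g′ : B ⇒ C} {h : C ⇒ D} → g ≤ g′ → f ⨾ g ⨾ h ≤ f ⨾ g′ ⨾ h
  inner-mono p = ⨾-monoʳ (⨾-monoˡ p)

  inner-cong : {f : A ⇒ B} {g g′ : B ⇒ C} {h : C ⇒ D} → g ≈ g′ → f ⨾ g ⨾ h ≈ f ⨾ g′ ⨾ h
  inner-cong p = refl⟩⨾⟨ p ⟩⨾⟨refl

  pullˡ-≤ : {f : A ⇒ B} {g : B ⇒ C} {h : A ⇒ C} {k : C ⇒ D} → f ⨾ g ≤ h → f ⨾ g ⨾ k ≤ h ⨾ k
  pullˡ-≤ p = ≈⇒≤ sym-assoc ○≤ ⨾-monoˡ p

  iso-cancelˡ : {x : A ⇒ B} {y : B ⇒ A} {f g : B ⇒ C} → y ⨾ x ≈ id → x ⨾ f ≈ x ⨾ g → f ≈ g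
  iso-cancelˡ yx p = introˡ yx ○ assoc ○ refl⟩⨾⟨ p ○ sym-assoc ○ elimˡ yx

  iso-cancelʳ : {x : B ⇒ C} {y : C ⇒ B} {f g : A ⇒ B} → x ⨾ y ≈ id → f ⨾ x ≈ g ⨾ x → f ≈ g
  iso-cancelʳ xy p = introʳ xy ○ sym-assoc ○ p ⟩⨾⟨refl ○ assoc ○ elimʳ xy

  inverse-unique : {f : A ⇒ B} {f′ g′ : B ⇒ A} → f ⨾ f′ ≈ id → g′ ⨾ f ≈ id → f′ ≈ g′
  inverse-unique ff′ g′f = introˡ g′f ○ assoc ○ elimʳ ff′

  ⊕-homo′ : {f : A ⇒ B} {g : B ⇒ C} {h : D ⇒ E} {k : E ⇒ F} →
            (f ⊕₁ h) ⨾ (g ⊕₁ k) ≈ (f ⨾ g) ⊕₁ (h ⨾ k)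
  ⊕-homo′ = sym≈ ⊕-homo

  ⊕id-⨾ : {f : A ⇒ B} {g : B ⇒ C} → (f ⨾ g) ⊕₁ id {D} ≈ (f ⊕₁ id) ⨾ (g ⊕₁ id)
  ⊕id-⨾ = refl⟩⊕⟨ sym≈ idˡ ○ ⊕-homo

  id⊕-⨾ : {f : A ⇒ B} {g : B ⇒ C} → id {D} ⊕₁ (f ⨾ g) ≈ (id ⊕₁ f) ⨾ (id ⊕₁ g)
  id⊕-⨾ = sym≈ idˡ ⟩⊕⟨refl ○ ⊕-homo

  ⊕-split : {f : A ⇒ B} {g : C ⇒ D} → f ⊕₁ g ≈ (f ⊕₁ id) ⨾ (id ⊕₁ g)
  ⊕-split = sym≈ idʳ ⟩⊕⟨ sym≈ idˡ ○ ⊕-homo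

  ⊕-split′ : {f : A ⇒ B} {g : C ⇒ D} → f ⊕₁ g ≈ (id ⊕₁ g) ⨾ (f ⊕₁ id)
  ⊕-split′ = sym≈ idˡ ⟩⊕⟨ sym≈ idʳ ○ ⊕-homo

  ⊕id-iso : {f : A ⇒ B} {g : B ⇒ A} → f ⨾ g ≈ id → (f ⊕₁ id {C}) ⨾ (g ⊕₁ id) ≈ id
  ⊕id-iso p = sym≈ ⊕id-⨾ ○ p ⟩⊕⟨refl ○ ⊕-identity

  id⊕-iso : {f : A ⇒ B} {g : B ⇒ A} → f ⨾ g ≈ id → (id {C} ⊕₁ f) ⨾ (id ⊕₁ g) ≈ id
  id⊕-iso p = sym≈ id⊕-⨾ ○ refl⟩⊕⟨ p ○ ⊕-identity

module Monoidal {o ℓ e r} (𝒞 : SymMonPosCat o ℓ e r) where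
  open Reasoning 𝒞 public

  private variable
    A B C D E F A′ B′ C′ D′ : Obj

  α⇐-natural : {f : A ⇒ B} {g : C ⇒ D} {h : E ⇒ F} →
               (f ⊕₁ (g ⊕₁ h)) ⨾ α⇐ ≈ α⇐ ⨾ ((f ⊕₁ g) ⊕₁ h)
  α⇐-natural = introˡ α-isoʳ ○ assoc ○ refl⟩⨾⟨ (pullˡ (sym≈ α-natural) ○ assoc ○ elimʳ α-isoˡ)

  λ⇐-natural : {f : A ⇒ B} → f ⨾ λ⇐ ≈ λ⇐ ⨾ (id ⊕₁ f)
  λ⇐-natural = introˡ λ-isoʳ ○ assoc ○ refl⟩⨾⟨ (pullˡ (sym≈ λ-natural) ○ assoc ○ elimʳ λ-isoˡ)

  ρ⇐-natural : {f : A ⇒ B} → f ⨾ ρ⇐ ≈ ρ⇐ ⨾ (f ⊕₁ id)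
  ρ⇐-natural = introˡ ρ-isoʳ ○ assoc ○ refl⟩⨾⟨ (pullˡ (sym≈ ρ-natural) ○ assoc ○ elimʳ ρ-isoˡ)

  id⊕-injective : {f g : A ⇒ B} → id {𝟎} ⊕₁ f ≈ id ⊕₁ g → f ≈ g
  id⊕-injective p =
    introˡ λ-isoʳ ○ assoc ○ refl⟩⨾⟨ (sym≈ λ-natural ○ p ⟩⨾⟨refl ○ λ-natural) ○ sym-assoc ○ elimˡ λ-isoʳ

  ⊕id-injective : {f g : A ⇒ B} → f ⊕₁ id {𝟎} ≈ g ⊕₁ id → f ≈ g
  ⊕id-injective p =
    introˡ ρ-isoʳ ○ assoc ○ refl⟩⨾⟨ (sym≈ ρ-natural ○ p ⟩⨾⟨refl ○ ρ-natural) ○ sym-assoc ○ elimˡ ρ-isoʳ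

  -- Kelly's lemma: after whiskering by an object A both sides are computed by the pentagon and triangle.
  kelly₁ : α⇒ {𝟎} {B} {C} ⨾ λ⇒ ≈ λ⇒ ⊕₁ id
  kelly₁ {B} {C} = id⊕-injective (iso-cancelˡ {x = whisker} retraction whiskered)
    where
    whisker : ((A ⊕ 𝟎) ⊕ B) ⊕ C ⇒ A ⊕ ((𝟎 ⊕ B) ⊕ C)
    whisker = (α⇒ ⊕₁ id) ⨾ α⇒
    retraction : (α⇐ ⨾ (α⇐ ⊕₁ id)) ⨾ whisker {A} ≈ id
    retraction = assoc ○ refl⟩⨾⟨ (sym-assoc ○ elimˡ (⊕id-iso α-isoʳ)) ○ α-isoʳ
    whiskered : whisker {A} ⨾ (id ⊕₁ (α⇒ ⨾ λ⇒)) ≈ whisker ⨾ (id ⊕₁ (λ⇒ ⊕₁ id))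
    whiskered = begin-equality
      whisker ⨾ (id ⊕₁ (α⇒ ⨾ λ⇒))          ≈⟨ refl⟩⨾⟨ id⊕-⨾ ○ sym-assoc ○ (assoc ○ pentagon) ⟩⨾⟨refl ⟩
      (α⇒ ⨾ α⇒) ⨾ (id ⊕₁ λ⇒)               ≈⟨ assoc ○ refl⟩⨾⟨ triangle ⟩
      α⇒ ⨾ (ρ⇒ ⊕₁ id)                      ≈⟨ refl⟩⨾⟨ refl⟩⊕⟨ sym≈ ⊕-identity ○ sym≈ α-natural ⟩
      ((ρ⇒ ⊕₁ id) ⊕₁ id) ⨾ α⇒              ≈⟨ (sym≈ triangle ⟩⊕⟨refl ○ ⊕id-⨾) ⟩⨾⟨refl ○ assoc ⟩
      (α⇒ ⊕₁ id) ⨾ ((id ⊕₁ λ⇒) ⊕₁ id) ⨾ α⇒ ≈⟨ refl⟩⨾⟨ α-natural ○ sym-assoc ⟩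
      whisker ⨾ (id ⊕₁ (λ⇒ ⊕₁ id))         ∎

  σ⨾λ⇒ : σ {A} {𝟎} ⨾ λ⇒ ≈ ρ⇒
  σ⨾λ⇒ = sym≈ (⊕id-injective (iso-cancelʳ symmetry whiskered))
    where
    whiskered : (ρ⇒ {A} ⊕₁ id {C}) ⨾ σ ≈ ((σ ⨾ λ⇒) ⊕₁ id) ⨾ σ
    whiskered = begin-equality
      (ρ⇒ ⊕₁ id) ⨾ σ                 ≈⟨ sym≈ triangle ⟩⨾⟨refl ○ assoc ⟩
      α⇒ ⨾ (id ⊕₁ λ⇒) ⨾ σ            ≈⟨ refl⟩⨾⟨ σ-natural ○ refl⟩⨾⟨ refl⟩⨾⟨ sym≈ kelly₁ ⟩
      α⇒ ⨾ σ ⨾ α⇒ ⨾ λ⇒               ≈⟨ refl⟩⨾⟨ sym-assoc ○ sym-assoc ○ hexagon ⟩⨾⟨refl ○ assoc ○ refl⟩⨾⟨ assoc ⟩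
      (σ ⊕₁ id) ⨾ α⇒ ⨾ (id ⊕₁ σ) ⨾ λ⇒ ≈⟨ refl⟩⨾⟨ refl⟩⨾⟨ λ-natural ⟩
      (σ ⊕₁ id) ⨾ α⇒ ⨾ λ⇒ ⨾ σ        ≈⟨ refl⟩⨾⟨ pullˡ kelly₁ ○ pullˡ (sym≈ ⊕id-⨾) ⟩
      ((σ ⨾ λ⇒) ⊕₁ id) ⨾ σ           ∎

  σ⨾ρ⇒ : σ {𝟎} {A} ⨾ ρ⇒ ≈ λ⇒
  σ⨾ρ⇒ = refl⟩⨾⟨ sym≈ σ⨾λ⇒ ○ cancelˡ symmetry

  ρ⇐⨾σ : ρ⇐ {A} ⨾ σ ≈ λ⇐
  ρ⇐⨾σ = inverse-unique (assoc ○ refl⟩⨾⟨ cancelˡ ρ-isoˡ ○ symmetry) (refl⟩⨾⟨ σ⨾ρ⇒ ○ λ-isoʳ)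

  λ⇐⨾σ : λ⇐ {A} ⨾ σ ≈ ρ⇐
  λ⇐⨾σ = inverse-unique (assoc ○ refl⟩⨾⟨ cancelˡ λ-isoˡ ○ symmetry) (refl⟩⨾⟨ σ⨾λ⇒ ○ ρ-isoʳ)

  λ⇐⨾α⇐ : λ⇐ {B ⊕ C} ⨾ α⇐ {𝟎} {B} {C} ≈ λ⇐ ⊕₁ id
  λ⇐⨾α⇐ = inverse-unique (assoc ○ refl⟩⨾⟨ cancelˡ λ-isoˡ ○ α-isoˡ) (refl⟩⨾⟨ kelly₁ ○ ⊕id-iso λ-isoʳ)

  id⊕λ⇐⨾α⇐ : (id {A} ⊕₁ λ⇐ {B}) ⨾ α⇐ ≈ ρ⇐ ⊕₁ id
  id⊕λ⇐⨾α⇐ = inverse-unique (assoc ○ refl⟩⨾⟨ cancelˡ (id⊕-iso λ-isoˡ) ○ α-isoˡ) (refl⟩⨾⟨ triangle ○ ⊕id-iso ρ-isoʳ)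

  private
    exchange : B ⊕ (C ⊕ D) ⇒ C ⊕ (B ⊕ D)
    exchange = α⇐ ⨾ (σ ⊕₁ id) ⨾ α⇒

    exchange-natural : {b : A ⇒ A′} {c : B ⇒ B′} {d : C ⇒ C′} →
                       (b ⊕₁ (c ⊕₁ d)) ⨾ exchange ≈ exchange ⨾ (c ⊕₁ (b ⊕₁ d))
    exchange-natural {b = b} {c} {d} = begin-equality
      (b ⊕₁ (c ⊕₁ d)) ⨾ α⇐ ⨾ (σ ⊕₁ id) ⨾ α⇒ ≈⟨ pullˡ α⇐-natural ○ assoc ○ refl⟩⨾⟨ pullˡ ⊕-homo′ ⟩
      α⇐ ⨾ (((b ⊕₁ c) ⨾ σ) ⊕₁ (d ⨾ id)) ⨾ α⇒ ≈⟨ refl⟩⨾⟨ (σ-natural ⟩⊕⟨ (idʳ ○ sym≈ idˡ) ○ ⊕-homo) ⟩⨾⟨refl ⟩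
      α⇐ ⨾ ((σ ⊕₁ id) ⨾ ((c ⊕₁ b) ⊕₁ d)) ⨾ α⇒ ≈⟨ refl⟩⨾⟨ (assoc ○ refl⟩⨾⟨ α-natural) ⟩
      α⇐ ⨾ (σ ⊕₁ id) ⨾ α⇒ ⨾ (c ⊕₁ (b ⊕₁ d))   ≈⟨ sym-assoc ○ sym-assoc ○ assoc ⟩⨾⟨refl ⟩
      exchange ⨾ (c ⊕₁ (b ⊕₁ d))             ∎

    exchange-involutive : exchange {B} {C} {D} ⨾ exchange ≈ id
    exchange-involutive =
      assoc ○ refl⟩⨾⟨ (assoc ○ refl⟩⨾⟨ cancelˡ α-isoˡ) ○ refl⟩⨾⟨ pullˡ (⊕id-iso symmetry) ○ refl⟩⨾⟨ idˡ ○ α-isoʳ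

  τ-natural : {a : A ⇒ A′} {b : B ⇒ B′} {c : C ⇒ C′} {d : D ⇒ D′} →
              ((a ⊕₁ b) ⊕₁ (c ⊕₁ d)) ⨾ τ 𝒞 ≈ τ 𝒞 ⨾ ((a ⊕₁ c) ⊕₁ (b ⊕₁ d))
  τ-natural = pullˡ α-natural ○ assoc ○ refl⟩⨾⟨ (pullˡ whiskered ○ assoc ○ refl⟩⨾⟨ α⇐-natural)
            ○ refl⟩⨾⟨ sym-assoc ○ sym-assoc
    where
    whiskered = ⊕-homo′ ○ (idʳ ○ sym≈ idˡ) ⟩⊕⟨ exchange-natural ○ ⊕-homo

  τ-involutive : τ 𝒞 {A} {B} {C} {D} ⨾ τ 𝒞 ≈ id
  τ-involutive =
    assoc ○ refl⟩⨾⟨ (assoc ○ refl⟩⨾⟨ cancelˡ α-isoʳ) ○ refl⟩⨾⟨ pullˡ (id⊕-iso exchange-involutive)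
    ○ refl⟩⨾⟨ idˡ ○ α-isoˡ

module Semilattice {o ℓ e r} {𝒞 : SymMonPosCat o ℓ e r} (𝔅 : FinBiprodIdemConv 𝒞) where
  open Monoidal 𝒞 public
  open FinBiprodIdemConv 𝔅 public

  infixr 4 _⟩+⟨_ refl⟩+⟨_
  infixl 5 _⟩+⟨refl

  private variable
    A B X Y : Obj

  !-unique : (h : A ⇒ 𝟎) → h ≈ !
  !-unique h = introʳ !-𝟎 ○ !-hom

  ¡-unique : (h : 𝟎 ⇒ A) → h ≈ ¡
  ¡-unique h = introˡ ¡-𝟎 ○ ¡-hom

  !-unique₂ : (h k : A ⇒ 𝟎) → h ≈ k
  !-unique₂ h k = !-unique h ○ sym≈ (!-unique k)

  ¡-unique₂ : (h k : 𝟎 ⇒ A) → h ≈ k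
  ¡-unique₂ h k = ¡-unique h ○ sym≈ (¡-unique k)

  through-𝟎 : (u : A ⇒ 𝟎) (v : 𝟎 ⇒ B) → u ⨾ v ≈ 0ₕ
  through-𝟎 u v = !-unique u ⟩⨾⟨ ¡-unique v

  zeroˡ : {f : A ⇒ B} → 0ₕ {X} ⨾ f ≈ 0ₕ
  zeroˡ = assoc ○ refl⟩⨾⟨ ¡-hom

  zeroʳ : {f : A ⇒ B} → f ⨾ 0ₕ {B} {X} ≈ 0ₕ
  zeroʳ = sym-assoc ○ !-hom ⟩⨾⟨refl

  _⟩+⟨_ : {f f′ g g′ : A ⇒ B} → f ≈ f′ → g ≈ g′ → f + g ≈ f′ + g′
  p ⟩+⟨ q = refl⟩⨾⟨ (p ⟩⊕⟨ q) ⟩⨾⟨refl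

  refl⟩+⟨_ : {f g g′ : A ⇒ B} → g ≈ g′ → f + g ≈ f + g′
  refl⟩+⟨ q = refl≈ ⟩+⟨ q

  _⟩+⟨refl : {f f′ g : A ⇒ B} → f ≈ f′ → f + g ≈ f′ + g
  p ⟩+⟨refl = p ⟩+⟨ refl≈

  +-mono : {f f′ g g′ : A ⇒ B} → f ≤ f′ → g ≤ g′ → f + g ≤ f′ + g′
  +-mono p q = ⨾-monoʳ (⨾-monoˡ (⊕-mono p q))

  ⨾-distribˡ-+ : {h : X ⇒ A} {f g : A ⇒ B} → h ⨾ (f + g) ≈ h ⨾ f + h ⨾ g
  ⨾-distribˡ-+ = pullˡ Δ-hom ○ assoc ○ refl⟩⨾⟨ pullˡ ⊕-homo′

  ⨾-distribʳ-+ : {h : B ⇒ Y} {f g : A ⇒ B} → (f + g) ⨾ h ≈ f ⨾ h + g ⨾ h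
  ⨾-distribʳ-+ = assoc ○ refl⟩⨾⟨ (assoc ○ refl⟩⨾⟨ ∇-hom ○ pullˡ ⊕-homo′)

  ⨾-distrib-+ : {u : X ⇒ A} {f g : A ⇒ B} {v : B ⇒ Y} → u ⨾ (f + g) ⨾ v ≈ u ⨾ f ⨾ v + u ⨾ g ⨾ v
  ⨾-distrib-+ = refl⟩⨾⟨ ⨾-distribʳ-+ ○ ⨾-distribˡ-+

  +-comm : {f g : A ⇒ B} → f + g ≈ g + f
  +-comm = sym≈ Δ-cocomm ⟩⨾⟨ refl⟩⨾⟨ sym≈ ∇-comm
         ○ assoc ○ refl⟩⨾⟨ refl⟩⨾⟨ pullˡ σ-natural ○ refl⟩⨾⟨ (refl⟩⨾⟨ assoc ○ cancelˡ symmetry)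

  +-assoc : {f g h : A ⇒ B} → (f + g) + h ≈ f + (g + h)
  +-assoc {f = f} {g} {h} = begin-equality
    Δ ⨾ ((Δ ⨾ (f ⊕₁ g) ⨾ ∇) ⊕₁ h) ⨾ ∇
      ≈⟨ refl⟩⨾⟨ (refl⟩⊕⟨ (sym≈ idˡ ○ refl⟩⨾⟨ sym≈ idʳ) ○ ⊕-homo ○ refl⟩⨾⟨ ⊕-homo) ⟩⨾⟨refl ⟩
    Δ ⨾ ((Δ ⊕₁ id) ⨾ ((f ⊕₁ g) ⊕₁ h) ⨾ (∇ ⊕₁ id)) ⨾ ∇
      ≈⟨ refl⟩⨾⟨ (assoc ○ refl⟩⨾⟨ (assoc ○ refl⟩⨾⟨ ∇-assoc)) ⟩
    Δ ⨾ (Δ ⊕₁ id) ⨾ ((f ⊕₁ g) ⊕₁ h) ⨾ α⇒ ⨾ (id ⊕₁ ∇) ⨾ ∇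
      ≈⟨ refl⟩⨾⟨ refl⟩⨾⟨ (pullˡ α-natural ○ assoc) ⟩
    Δ ⨾ (Δ ⊕₁ id) ⨾ α⇒ ⨾ (f ⊕₁ (g ⊕₁ h)) ⨾ (id ⊕₁ ∇) ⨾ ∇
      ≈⟨ sym-assoc ○ sym-assoc ○ (assoc ○ Δ-coassoc) ⟩⨾⟨refl ○ assoc ⟩
    Δ ⨾ (id ⊕₁ Δ) ⨾ (f ⊕₁ (g ⊕₁ h)) ⨾ (id ⊕₁ ∇) ⨾ ∇
      ≈⟨ refl⟩⨾⟨ pullˡ ⊕-homo′ ○ refl⟩⨾⟨ pullˡ ⊕-homo′ ⟩
    Δ ⨾ (((id ⨾ f) ⨾ id) ⊕₁ ((Δ ⨾ (g ⊕₁ h)) ⨾ ∇)) ⨾ ∇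
      ≈⟨ refl⟩⨾⟨ (((idʳ ○ idˡ) ⟩⊕⟨ assoc) ⟩⨾⟨refl) ⟩
    Δ ⨾ (f ⊕₁ (Δ ⨾ (g ⊕₁ h) ⨾ ∇)) ⨾ ∇ ∎

  Δ⨾id⊕! : Δ {A} ⨾ (id ⊕₁ !) ≈ λ⇐ ⨾ σ
  Δ⨾id⊕! = sym≈ Δ-cocomm ⟩⨾⟨refl ○ assoc ○ refl⟩⨾⟨ sym≈ σ-natural ○ pullˡ Δ-counit

  id⊕¡⨾∇ : (id ⊕₁ ¡) ⨾ ∇ {A} ≈ σ ⨾ λ⇒
  id⊕¡⨾∇ = refl⟩⨾⟨ sym≈ ∇-comm ○ pullˡ σ-natural ○ assoc ○ refl⟩⨾⟨ ∇-unit

  +-identityʳ : {f : A ⇒ B} → f + 0ₕ ≈ f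
  +-identityʳ {f = f} = begin-equality
    Δ ⨾ (f ⊕₁ (! ⨾ ¡)) ⨾ ∇             ≈⟨ refl⟩⨾⟨ (sym≈ idʳ ⟩⊕⟨ (sym≈ !-hom ⟩⨾⟨refl ○ assoc) ○ ⊕-homo) ⟩⨾⟨refl ⟩
    Δ ⨾ ((f ⊕₁ f) ⨾ (id ⊕₁ (! ⨾ ¡))) ⨾ ∇ ≈⟨ refl⟩⨾⟨ assoc ○ pullˡ (sym≈ Δ-hom) ○ assoc ⟩
    f ⨾ Δ ⨾ (id ⊕₁ (! ⨾ ¡)) ⨾ ∇         ≈⟨ refl⟩⨾⟨ refl⟩⨾⟨ id⊕-⨾ ⟩⨾⟨refl ⟩
    f ⨾ Δ ⨾ ((id ⊕₁ !) ⨾ (id ⊕₁ ¡)) ⨾ ∇ ≈⟨ refl⟩⨾⟨ refl⟩⨾⟨ assoc ○ refl⟩⨾⟨ pullˡ Δ⨾id⊕! ○ refl⟩⨾⟨ assoc ⟩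
    f ⨾ λ⇐ ⨾ σ ⨾ (id ⊕₁ ¡) ⨾ ∇           ≈⟨ refl⟩⨾⟨ refl⟩⨾⟨ refl⟩⨾⟨ id⊕¡⨾∇ ○ refl⟩⨾⟨ refl⟩⨾⟨ cancelˡ symmetry ⟩
    f ⨾ λ⇐ ⨾ λ⇒                          ≈⟨ elimʳ λ-isoʳ ⟩
    f                                    ∎

  +-identityˡ : {f : A ⇒ B} → 0ₕ + f ≈ f
  +-identityˡ = +-comm ○ +-identityʳ

  0ₕ≤ : {f : A ⇒ B} → 0ₕ ≤ f
  0ₕ≤ = ≈⇒≤ (refl⟩⨾⟨ sym≈ ¡-hom ○ sym-assoc) ○≤ ⨾-monoˡ idem-! ○≤ ≈⇒≤ idˡ

  x≤x+y : {f g : A ⇒ B} → f ≤ f + g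
  x≤x+y = ≈⇒≥ +-identityʳ ○≤ +-mono ≤-refl 0ₕ≤

  y≤x+y : {f g : A ⇒ B} → g ≤ f + g
  y≤x+y = ≈⇒≥ +-identityˡ ○≤ +-mono 0ₕ≤ ≤-refl

  +-idem : {f : A ⇒ B} → f + f ≈ f
  +-idem = ≤-antisym (≈⇒≤ (pullˡ (sym≈ Δ-hom) ○ assoc) ○≤ ⨾-monoʳ idem-X ○≤ ≈⇒≤ idʳ) x≤x+y

  +-lub : {f g h : A ⇒ B} → f ≤ h → g ≤ h → f + g ≤ h
  +-lub p q = +-mono p q ○≤ ≈⇒≤ +-idem

  ⊕-+-interchange : {a c : A ⇒ B} {b d : X ⇒ Y} → (a ⊕₁ b) + (c ⊕₁ d) ≈ (a + c) ⊕₁ (b + d)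
  ⊕-+-interchange = Δ-⊕ ⟩⨾⟨ refl⟩⨾⟨ ∇-⊕ ○ assoc ○ refl⟩⨾⟨ pullˡ (sym≈ τ-natural)
                  ○ refl⟩⨾⟨ (assoc ○ refl⟩⨾⟨ cancelˡ τ-involutive) ○ refl⟩⨾⟨ ⊕-homo′ ○ ⊕-homo′

module Biproducts {o ℓ e r} {𝒞 : SymMonPosCat o ℓ e r} (𝔅 : FinBiprodIdemConv 𝒞) where
  open Semilattice 𝔅 public

  private variable
    A B C D : Obj

  π₁ : A ⊕ B ⇒ A
  π₁ = (id ⊕₁ !) ⨾ ρ⇒

  π₂ : A ⊕ B ⇒ B
  π₂ = (! ⊕₁ id) ⨾ λ⇒

  ι₁ : A ⇒ A ⊕ B
  ι₁ = ρ⇐ ⨾ (id ⊕₁ ¡)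

  ι₂ : ∀ {A B} → B ⇒ A ⊕ B
  ι₂ = λ⇐ ⨾ (¡ ⊕₁ id)

  private
    through-𝟎⊕𝟎 : (u : A ⇒ 𝟎 ⊕ 𝟎) (v : 𝟎 ⊕ 𝟎 ⇒ B) → u ⨾ v ≈ 0ₕ
    through-𝟎⊕𝟎 u v = introʳ λ-isoˡ ⟩⨾⟨refl ○ sym-assoc ⟩⨾⟨refl ○ assoc ○ through-𝟎 _ _

    ⊕-interchange : {f : A ⇒ B} {g : C ⇒ D} → (f ⊕₁ id) ⨾ (id ⊕₁ g) ≈ (id ⊕₁ g) ⨾ (f ⊕₁ id)
    ⊕-interchange = sym≈ ⊕-split ○ ⊕-split′

  ι₁⨾π₁ : ι₁ {A} {B} ⨾ π₁ ≈ id
  ι₁⨾π₁ = assoc ○ refl⟩⨾⟨ pullˡ (id⊕-iso (!-unique₂ _ _)) ○ refl⟩⨾⟨ idˡ ○ ρ-isoʳ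

  ι₂⨾π₂ : ι₂ {A} {B} ⨾ π₂ ≈ id
  ι₂⨾π₂ = assoc ○ refl⟩⨾⟨ pullˡ (⊕id-iso (!-unique₂ _ _)) ○ refl⟩⨾⟨ idˡ ○ λ-isoʳ

  ι₁⨾π₂ : ι₁ {A} {B} ⨾ π₂ ≈ 0ₕ
  ι₁⨾π₂ = assoc ○ refl⟩⨾⟨ (pullˡ (sym≈ ⊕-interchange) ○ assoc) ○ sym-assoc ○ through-𝟎⊕𝟎 _ _

  ι₂⨾π₁ : ι₂ {A} {B} ⨾ π₁ ≈ 0ₕ
  ι₂⨾π₁ = assoc ○ refl⟩⨾⟨ (pullˡ ⊕-interchange ○ assoc) ○ sym-assoc ○ through-𝟎⊕𝟎 _ _

  π₁⨾ι₁ : π₁ {A} {B} ⨾ ι₁ {A} {B} ≈ id ⊕₁ 0ₕ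
  π₁⨾ι₁ = assoc ○ refl⟩⨾⟨ cancelˡ ρ-isoˡ ○ sym≈ id⊕-⨾

  π₂⨾ι₂ : π₂ {A} {B} ⨾ ι₂ {A} {B} ≈ 0ₕ ⊕₁ id
  π₂⨾ι₂ = assoc ○ refl⟩⨾⟨ cancelˡ λ-isoˡ ○ sym≈ ⊕id-⨾

  π⨾ι-sum : π₁ {A} {B} ⨾ ι₁ + π₂ ⨾ ι₂ ≈ id
  π⨾ι-sum = π₁⨾ι₁ ⟩+⟨ π₂⨾ι₂ ○ ⊕-+-interchange ○ +-identityʳ ⟩⊕⟨ +-identityˡ ○ ⊕-identity

  π₁-natural : {f : A ⇒ B} {g : C ⇒ D} → (f ⊕₁ g) ⨾ π₁ ≈ π₁ ⨾ f
  π₁-natural = pullˡ (⊕-homo′ ○ (idʳ ○ sym≈ idˡ) ⟩⊕⟨ (!-unique₂ _ _ ○ sym≈ idʳ) ○ ⊕-homo)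
             ○ assoc ○ refl⟩⨾⟨ ρ-natural ○ sym-assoc

  π₂-natural : {f : A ⇒ B} {g : C ⇒ D} → (f ⊕₁ g) ⨾ π₂ ≈ π₂ ⨾ g
  π₂-natural = pullˡ (⊕-homo′ ○ (!-unique₂ _ _ ○ sym≈ idʳ) ⟩⊕⟨ (idʳ ○ sym≈ idˡ) ○ ⊕-homo)
             ○ assoc ○ refl⟩⨾⟨ λ-natural ○ sym-assoc

  ι₁-natural : {f : A ⇒ B} {g : C ⇒ D} → ι₁ ⨾ (f ⊕₁ g) ≈ f ⨾ ι₁
  ι₁-natural = assoc ○ refl⟩⨾⟨ (⊕-homo′ ○ (idˡ ○ sym≈ idʳ) ⟩⊕⟨ (¡-unique₂ _ _ ○ sym≈ idˡ) ○ ⊕-homo)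
             ○ pullˡ (sym≈ ρ⇐-natural) ○ assoc

  ι₂-natural : {f : A ⇒ B} {g : C ⇒ D} → ι₂ ⨾ (f ⊕₁ g) ≈ g ⨾ ι₂
  ι₂-natural = assoc ○ refl⟩⨾⟨ (⊕-homo′ ○ (¡-unique₂ _ _ ○ sym≈ idˡ) ⟩⊕⟨ (idˡ ○ sym≈ idʳ) ○ ⊕-homo)
             ○ pullˡ (sym≈ λ⇐-natural) ○ assoc

  ι₂≈λ⇐ : ι₂ {𝟎} {A} ≈ λ⇐
  ι₂≈λ⇐ = elimʳ (¡-unique₂ _ _ ⟩⊕⟨refl ○ ⊕-identity)

  π₂≈λ⇒ : π₂ {𝟎} {A} ≈ λ⇒
  π₂≈λ⇒ = elimˡ (!-unique₂ _ _ ⟩⊕⟨refl ○ ⊕-identity)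

  ι₁⨾σ : ι₁ {A} {B} ⨾ σ ≈ ι₂
  ι₁⨾σ = assoc ○ refl⟩⨾⟨ σ-natural ○ pullˡ ρ⇐⨾σ

  ι₂⨾σ : ι₂ {A} {B} ⨾ σ ≈ ι₁
  ι₂⨾σ = assoc ○ refl⟩⨾⟨ σ-natural ○ pullˡ λ⇐⨾σ

  σ⨾π₁ : σ {A} {B} ⨾ π₁ ≈ π₂
  σ⨾π₁ = pullˡ (sym≈ σ-natural) ○ assoc ○ refl⟩⨾⟨ σ⨾ρ⇒

  σ⨾π₂ : σ {A} {B} ⨾ π₂ ≈ π₁
  σ⨾π₂ = pullˡ (sym≈ σ-natural) ○ assoc ○ refl⟩⨾⟨ σ⨾λ⇒

  ι₁⨾∇ : ι₁ ⨾ ∇ {A} ≈ id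
  ι₁⨾∇ = assoc ○ refl⟩⨾⟨ id⊕¡⨾∇ ○ refl⟩⨾⟨ σ⨾λ⇒ ○ ρ-isoʳ

  ι₂⨾∇ : ι₂ ⨾ ∇ {A} ≈ id
  ι₂⨾∇ = assoc ○ refl⟩⨾⟨ ∇-unit ○ λ-isoʳ

  Δ⨾π₁ : Δ {A} ⨾ π₁ ≈ id
  Δ⨾π₁ = pullˡ Δ⨾id⊕! ○ assoc ○ refl⟩⨾⟨ σ⨾ρ⇒ ○ λ-isoʳ

  Δ⨾π₂ : Δ {A} ⨾ π₂ ≈ id
  Δ⨾π₂ = pullˡ Δ-counit ○ λ-isoʳ

  α⇒⨾π₁ : α⇒ {A} {B} {C} ⨾ π₁ ≈ π₁ ⨾ π₁
  α⇒⨾π₁ = begin-equality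
    α⇒ ⨾ (id ⊕₁ !) ⨾ ρ⇒                      ≈⟨ refl⟩⨾⟨ (refl⟩⊕⟨ !-⊕ ○ id⊕-⨾) ⟩⨾⟨refl ⟩
    α⇒ ⨾ ((id ⊕₁ (! ⊕₁ !)) ⨾ (id ⊕₁ λ⇒)) ⨾ ρ⇒ ≈⟨ refl⟩⨾⟨ assoc ○ pullˡ (sym≈ α-natural) ○ assoc ⟩
    ((id ⊕₁ !) ⊕₁ !) ⨾ α⇒ ⨾ (id ⊕₁ λ⇒) ⨾ ρ⇒   ≈⟨ refl⟩⨾⟨ pullˡ triangle ○ refl⟩⨾⟨ ρ-natural ⟩
    ((id ⊕₁ !) ⊕₁ !) ⨾ ρ⇒ ⨾ ρ⇒                ≈⟨ ⊕-split′ ⟩⨾⟨refl ○ assoc ○ refl⟩⨾⟨ pullˡ ρ-natural ⟩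
    (id ⊕₁ !) ⨾ (ρ⇒ ⨾ (id ⊕₁ !)) ⨾ ρ⇒         ≈⟨ refl⟩⨾⟨ assoc ○ sym-assoc ⟩
    ((id ⊕₁ !) ⨾ ρ⇒) ⨾ (id ⊕₁ !) ⨾ ρ⇒         ∎

  α⇒⨾π₂ : α⇒ {A} {B} {C} ⨾ π₂ ≈ π₂ ⊕₁ id
  α⇒⨾π₂ = refl⟩⨾⟨ (refl⟩⊕⟨ sym≈ ⊕-identity) ⟩⨾⟨refl ○ pullˡ (sym≈ α-natural) ○ assoc
        ○ refl⟩⨾⟨ kelly₁ ○ sym≈ ⊕id-⨾

  ι₂⨾α⇐ : ι₂ {A} {B ⊕ C} ⨾ α⇐ ≈ ι₂ ⊕₁ id
  ι₂⨾α⇐ = assoc ○ refl⟩⨾⟨ ((refl⟩⊕⟨ sym≈ ⊕-identity) ⟩⨾⟨refl ○ α⇐-natural)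
        ○ pullˡ λ⇐⨾α⇐ ○ sym≈ ⊕id-⨾

  ι₁⨾α⇐ : ι₁ {A} {B ⊕ C} ⨾ α⇐ ≈ ι₁ ⨾ ι₁
  ι₁⨾α⇐ = begin-equality
    (ρ⇐ ⨾ (id ⊕₁ ¡)) ⨾ α⇐                      ≈⟨ assoc ○ refl⟩⨾⟨ ((refl⟩⊕⟨ ¡-⊕ ○ id⊕-⨾) ⟩⨾⟨refl ○ assoc) ⟩
    ρ⇐ ⨾ (id ⊕₁ λ⇐) ⨾ (id ⊕₁ (¡ ⊕₁ ¡)) ⨾ α⇐    ≈⟨ refl⟩⨾⟨ refl⟩⨾⟨ α⇐-natural ○ refl⟩⨾⟨ pullˡ id⊕λ⇐⨾α⇐ ⟩
    ρ⇐ ⨾ (ρ⇐ ⊕₁ id) ⨾ ((id ⊕₁ ¡) ⊕₁ ¡)         ≈⟨ pullˡ (sym≈ ρ⇐-natural) ○ assoc ○ refl⟩⨾⟨ refl⟩⨾⟨ ⊕-split ⟩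
    ρ⇐ ⨾ ρ⇐ ⨾ ((id ⊕₁ ¡) ⊕₁ id) ⨾ (id ⊕₁ ¡)    ≈⟨ refl⟩⨾⟨ (pullˡ (sym≈ ρ⇐-natural) ○ assoc) ○ sym-assoc ⟩
    (ρ⇐ ⨾ (id ⊕₁ ¡)) ⨾ ρ⇐ ⨾ (id ⊕₁ ¡)          ∎

  ι₁⨾ι₂⨾α⇐ : (ι₁ {B} {C} ⨾ ι₂ {A}) ⨾ α⇐ ≈ ι₂ ⨾ ι₁
  ι₁⨾ι₂⨾α⇐ = assoc ○ refl⟩⨾⟨ ι₂⨾α⇐ ○ ι₁-natural

  ι₂⨾ι₂⨾α⇐ : (ι₂ {B} {C} ⨾ ι₂ {A}) ⨾ α⇐ ≈ ι₂
  ι₂⨾ι₂⨾α⇐ = assoc ○ refl⟩⨾⟨ ι₂⨾α⇐ ○ ι₂-natural ○ idˡ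

  α⇒⨾π₂⨾π₁ : α⇒ {A} {B} {C} ⨾ π₂ ⨾ π₁ ≈ π₁ ⨾ π₂
  α⇒⨾π₂⨾π₁ = pullˡ α⇒⨾π₂ ○ π₁-natural

  α⇒⨾π₂⨾π₂ : α⇒ {A} {B} {C} ⨾ π₂ ⨾ π₂ ≈ π₂
  α⇒⨾π₂⨾π₂ = pullˡ α⇒⨾π₂ ○ π₂-natural ○ idʳ

module Matrices {o ℓ e r} {𝒞 : SymMonPosCat o ℓ e r} (𝔅 : FinBiprodIdemConv 𝒞) where
  open Biproducts 𝔅 public

  private variable
    A B C D S T X Y S′ T′ X′ Y′ : Obj

  [_]₁₁ : S ⊕ X ⇒ T ⊕ Y → S ⇒ T
  [ K ]₁₁ = ι₁ ⨾ K ⨾ π₁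

  [_]₁₂ : S ⊕ X ⇒ T ⊕ Y → S ⇒ Y
  [ K ]₁₂ = ι₁ ⨾ K ⨾ π₂

  [_]₂₁ : S ⊕ X ⇒ T ⊕ Y → X ⇒ T
  [ K ]₂₁ = ι₂ ⨾ K ⨾ π₁

  [_]₂₂ : S ⊕ X ⇒ T ⊕ Y → X ⇒ Y
  [ K ]₂₂ = ι₂ ⨾ K ⨾ π₂

  mat : S ⇒ T → S ⇒ Y → X ⇒ T → X ⇒ Y → S ⊕ X ⇒ T ⊕ Y
  mat a b c d = (π₁ ⨾ a ⨾ ι₁ + π₁ ⨾ b ⨾ ι₂) + (π₂ ⨾ c ⨾ ι₁ + π₂ ⨾ d ⨾ ι₂)

  assoc-sandwich : {u : A ⇒ B} {v : B ⇒ C} {x : C ⇒ D} {w : D ⇒ S} {y : S ⇒ T} →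
                   (u ⨾ v) ⨾ x ⨾ (w ⨾ y) ≈ u ⨾ (v ⨾ x ⨾ w) ⨾ y
  assoc-sandwich = assoc ○ refl⟩⨾⟨ (refl⟩⨾⟨ sym-assoc ○ sym-assoc)

  mat-η : ∀ {S X T Y} {K : S ⊕ X ⇒ T ⊕ Y} → K ≈ mat [ K ]₁₁ [ K ]₁₂ [ K ]₂₁ [ K ]₂₂
  mat-η {S} {X} {T} {Y} {K} =
    introˡ (π⨾ι-sum {S} {X}) ○ refl⟩⨾⟨ introʳ (π⨾ι-sum {T} {Y}) ○ ⨾-distribʳ-+ ○ expand ⟩+⟨ expand
    where
    expand : ∀ {Z} {p : S ⊕ X ⇒ Z} {i : Z ⇒ S ⊕ X} →
             (p ⨾ i) ⨾ K ⨾ (π₁ ⨾ ι₁ + π₂ ⨾ ι₂) ≈ p ⨾ (i ⨾ K ⨾ π₁) ⨾ ι₁ + p ⨾ (i ⨾ K ⨾ π₂) ⨾ ι₂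
    expand = refl⟩⨾⟨ ⨾-distribˡ-+ ○ ⨾-distribˡ-+ ○ assoc-sandwich ⟩+⟨ assoc-sandwich

  mat-mono : {a a′ : S ⇒ T} {b b′ : S ⇒ Y} {c c′ : X ⇒ T} {d d′ : X ⇒ Y} →
             a ≤ a′ → b ≤ b′ → c ≤ c′ → d ≤ d′ → mat a b c d ≤ mat a′ b′ c′ d′
  mat-mono p q s t = +-mono (+-mono (inner-mono p) (inner-mono q)) (+-mono (inner-mono s) (inner-mono t))

  mat-cong : {a a′ : S ⇒ T} {b b′ : S ⇒ Y} {c c′ : X ⇒ T} {d d′ : X ⇒ Y} →
             a ≈ a′ → b ≈ b′ → c ≈ c′ → d ≈ d′ → mat a b c d ≈ mat a′ b′ c′ d′
  mat-cong p q s t = ≤-antisym (mat-mono (≈⇒≤ p) (≈⇒≤ q) (≈⇒≤ s) (≈⇒≤ t))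
                               (mat-mono (≈⇒≥ p) (≈⇒≥ q) (≈⇒≥ s) (≈⇒≥ t))

  entrywise-≤ : {K L : S ⊕ X ⇒ T ⊕ Y} →
                [ K ]₁₁ ≤ [ L ]₁₁ → [ K ]₁₂ ≤ [ L ]₁₂ → [ K ]₂₁ ≤ [ L ]₂₁ → [ K ]₂₂ ≤ [ L ]₂₂ → K ≤ L
  entrywise-≤ p q s t = ≈⇒≤ mat-η ○≤ mat-mono p q s t ○≤ ≈⇒≥ mat-η

  entrywise : {K L : S ⊕ X ⇒ T ⊕ Y} →
              [ K ]₁₁ ≈ [ L ]₁₁ → [ K ]₁₂ ≈ [ L ]₁₂ → [ K ]₂₁ ≈ [ L ]₂₁ → [ K ]₂₂ ≈ [ L ]₂₂ → K ≈ L
  entrywise p q s t = mat-η ○ mat-cong p q s t ○ sym≈ mat-η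

  private
    sandwich-cancel : {u : A ⇒ B} {v : B ⇒ A} {x : A ⇒ D} {w : D ⇒ C} {y : C ⇒ D} →
                      u ⨾ v ≈ id → w ⨾ y ≈ id → u ⨾ (v ⨾ x ⨾ w) ⨾ y ≈ x
    sandwich-cancel p q = ⨾-sandwich p q ○ idˡ ○ idʳ

    sandwich-zeroˡ : {u : A ⇒ B} {v : B ⇒ C} {x : C ⇒ D} {w : D ⇒ S′} {y : S′ ⇒ T′} →
                     u ⨾ v ≈ 0ₕ → u ⨾ (v ⨾ x ⨾ w) ⨾ y ≈ 0ₕ
    sandwich-zeroˡ p = ⨾-sandwich p refl≈ ○ zeroˡ

    sandwich-zeroʳ : {u : A ⇒ B} {v : B ⇒ C} {x : C ⇒ D} {w : D ⇒ S′} {y : S′ ⇒ T′} →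
                     w ⨾ y ≈ 0ₕ → u ⨾ (v ⨾ x ⨾ w) ⨾ y ≈ 0ₕ
    sandwich-zeroʳ q = ⨾-sandwich refl≈ q ○ refl⟩⨾⟨ zeroʳ ○ zeroʳ

  module _ {a : S ⇒ T} {b : S ⇒ Y} {c : X ⇒ T} {d : X ⇒ Y} where
    private
      expand : {u : A ⇒ S ⊕ X} {v : T ⊕ Y ⇒ B} →
               u ⨾ mat a b c d ⨾ v ≈ (u ⨾ (π₁ ⨾ a ⨾ ι₁) ⨾ v + u ⨾ (π₁ ⨾ b ⨾ ι₂) ⨾ v)
                                   + (u ⨾ (π₂ ⨾ c ⨾ ι₁) ⨾ v + u ⨾ (π₂ ⨾ d ⨾ ι₂) ⨾ v)
      expand = ⨾-distrib-+ ○ ⨾-distrib-+ ⟩+⟨ ⨾-distrib-+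

    [mat]₁₁ : [ mat a b c d ]₁₁ ≈ a
    [mat]₁₁ = expand ○ (sandwich-cancel ι₁⨾π₁ ι₁⨾π₁ ⟩+⟨ sandwich-zeroʳ ι₂⨾π₁)
                ⟩+⟨ (sandwich-zeroˡ ι₁⨾π₂ ⟩+⟨ sandwich-zeroˡ ι₁⨾π₂)
            ○ +-identityʳ ⟩+⟨ +-identityʳ ○ +-identityʳ

    [mat]₁₂ : [ mat a b c d ]₁₂ ≈ b
    [mat]₁₂ = expand ○ (sandwich-zeroʳ ι₁⨾π₂ ⟩+⟨ sandwich-cancel ι₁⨾π₁ ι₂⨾π₂)
                ⟩+⟨ (sandwich-zeroˡ ι₁⨾π₂ ⟩+⟨ sandwich-zeroˡ ι₁⨾π₂)
            ○ +-identityˡ ⟩+⟨ +-identityʳ ○ +-identityʳ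

    [mat]₂₁ : [ mat a b c d ]₂₁ ≈ c
    [mat]₂₁ = expand ○ (sandwich-zeroˡ ι₂⨾π₁ ⟩+⟨ sandwich-zeroˡ ι₂⨾π₁)
                ⟩+⟨ (sandwich-cancel ι₂⨾π₂ ι₁⨾π₁ ⟩+⟨ sandwich-zeroʳ ι₂⨾π₁)
            ○ +-identityʳ ⟩+⟨ +-identityʳ ○ +-identityˡ

    [mat]₂₂ : [ mat a b c d ]₂₂ ≈ d
    [mat]₂₂ = expand ○ (sandwich-zeroˡ ι₂⨾π₁ ⟩+⟨ sandwich-zeroˡ ι₂⨾π₁)
                ⟩+⟨ (sandwich-zeroʳ ι₁⨾π₂ ⟩+⟨ sandwich-cancel ι₂⨾π₂ ι₂⨾π₂)
            ○ +-identityʳ ⟩+⟨ +-identityˡ ○ +-identityˡ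

  module _ {K : S ⊕ X ⇒ T ⊕ Y} {x : S′ ⇒ S} {y : X′ ⇒ X} where
    [⊕⨾-]₁₁ : [ (x ⊕₁ y) ⨾ K ]₁₁ ≈ x ⨾ [ K ]₁₁
    [⊕⨾-]₁₁ = refl⟩⨾⟨ assoc ○ sym-assoc ○ ι₁-natural ⟩⨾⟨refl ○ assoc

    [⊕⨾-]₁₂ : [ (x ⊕₁ y) ⨾ K ]₁₂ ≈ x ⨾ [ K ]₁₂
    [⊕⨾-]₁₂ = refl⟩⨾⟨ assoc ○ sym-assoc ○ ι₁-natural ⟩⨾⟨refl ○ assoc

    [⊕⨾-]₂₁ : [ (x ⊕₁ y) ⨾ K ]₂₁ ≈ y ⨾ [ K ]₂₁
    [⊕⨾-]₂₁ = refl⟩⨾⟨ assoc ○ sym-assoc ○ ι₂-natural ⟩⨾⟨refl ○ assoc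

    [⊕⨾-]₂₂ : [ (x ⊕₁ y) ⨾ K ]₂₂ ≈ y ⨾ [ K ]₂₂
    [⊕⨾-]₂₂ = refl⟩⨾⟨ assoc ○ sym-assoc ○ ι₂-natural ⟩⨾⟨refl ○ assoc

  module _ {K : S ⊕ X ⇒ T ⊕ Y} {z : T ⇒ T′} {w : Y ⇒ Y′} where
    [-⨾⊕]₁₁ : [ K ⨾ (z ⊕₁ w) ]₁₁ ≈ [ K ]₁₁ ⨾ z
    [-⨾⊕]₁₁ = refl⟩⨾⟨ (assoc ○ refl⟩⨾⟨ π₁-natural ○ sym-assoc) ○ sym-assoc

    [-⨾⊕]₁₂ : [ K ⨾ (z ⊕₁ w) ]₁₂ ≈ [ K ]₁₂ ⨾ w
    [-⨾⊕]₁₂ = refl⟩⨾⟨ (assoc ○ refl⟩⨾⟨ π₂-natural ○ sym-assoc) ○ sym-assoc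

    [-⨾⊕]₂₁ : [ K ⨾ (z ⊕₁ w) ]₂₁ ≈ [ K ]₂₁ ⨾ z
    [-⨾⊕]₂₁ = refl⟩⨾⟨ (assoc ○ refl⟩⨾⟨ π₁-natural ○ sym-assoc) ○ sym-assoc

    [-⨾⊕]₂₂ : [ K ⨾ (z ⊕₁ w) ]₂₂ ≈ [ K ]₂₂ ⨾ w
    [-⨾⊕]₂₂ = refl⟩⨾⟨ (assoc ○ refl⟩⨾⟨ π₂-natural ○ sym-assoc) ○ sym-assoc

  module _ {K : S ⊕ X ⇒ T ⊕ Y} {x : S′ ⇒ S} {y : X′ ⇒ X} {z : T ⇒ T′} {w : Y ⇒ Y′} where
    [⊕⨾-⨾⊕]₁₁ : [ (x ⊕₁ y) ⨾ K ⨾ (z ⊕₁ w) ]₁₁ ≈ x ⨾ [ K ]₁₁ ⨾ z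
    [⊕⨾-⨾⊕]₁₁ = [⊕⨾-]₁₁ ○ refl⟩⨾⟨ [-⨾⊕]₁₁

    [⊕⨾-⨾⊕]₁₂ : [ (x ⊕₁ y) ⨾ K ⨾ (z ⊕₁ w) ]₁₂ ≈ x ⨾ [ K ]₁₂ ⨾ w
    [⊕⨾-⨾⊕]₁₂ = [⊕⨾-]₁₂ ○ refl⟩⨾⟨ [-⨾⊕]₁₂

    [⊕⨾-⨾⊕]₂₁ : [ (x ⊕₁ y) ⨾ K ⨾ (z ⊕₁ w) ]₂₁ ≈ y ⨾ [ K ]₂₁ ⨾ z
    [⊕⨾-⨾⊕]₂₁ = [⊕⨾-]₂₁ ○ refl⟩⨾⟨ [-⨾⊕]₂₁

    [⊕⨾-⨾⊕]₂₂ : [ (x ⊕₁ y) ⨾ K ⨾ (z ⊕₁ w) ]₂₂ ≈ y ⨾ [ K ]₂₂ ⨾ w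
    [⊕⨾-⨾⊕]₂₂ = [⊕⨾-]₂₂ ○ refl⟩⨾⟨ [-⨾⊕]₂₂

  [σ]₁₁ : [ σ {A} {B} ]₁₁ ≈ 0ₕ
  [σ]₁₁ = pullˡ ι₁⨾σ ○ ι₂⨾π₁

  [σ]₁₂ : [ σ {A} {B} ]₁₂ ≈ id
  [σ]₁₂ = pullˡ ι₁⨾σ ○ ι₂⨾π₂

  [σ]₂₁ : [ σ {A} {B} ]₂₁ ≈ id
  [σ]₂₁ = pullˡ ι₂⨾σ ○ ι₁⨾π₁

  [σ]₂₂ : [ σ {A} {B} ]₂₂ ≈ 0ₕ
  [σ]₂₂ = pullˡ ι₂⨾σ ○ ι₁⨾π₂

  module _ {K : S ⊕ X ⇒ T ⊕ Y} where
    [σ⨾-⨾σ]₁₁ : [ σ ⨾ K ⨾ σ ]₁₁ ≈ [ K ]₂₂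
    [σ⨾-⨾σ]₁₁ = ⨾-sandwich ι₁⨾σ σ⨾π₁

    [σ⨾-⨾σ]₁₂ : [ σ ⨾ K ⨾ σ ]₁₂ ≈ [ K ]₂₁
    [σ⨾-⨾σ]₁₂ = ⨾-sandwich ι₁⨾σ σ⨾π₂

    [σ⨾-⨾σ]₂₁ : [ σ ⨾ K ⨾ σ ]₂₁ ≈ [ K ]₁₂
    [σ⨾-⨾σ]₂₁ = ⨾-sandwich ι₂⨾σ σ⨾π₁

    [σ⨾-⨾σ]₂₂ : [ σ ⨾ K ⨾ σ ]₂₂ ≈ [ K ]₁₁
    [σ⨾-⨾σ]₂₂ = ⨾-sandwich ι₂⨾σ σ⨾π₂

  private
    ∇⨾Δ-entry : {u : A ⇒ A ⊕ A} {v : A ⊕ A ⇒ A} → u ⨾ ∇ ≈ id → Δ ⨾ v ≈ id → u ⨾ (∇ ⨾ Δ) ⨾ v ≈ id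
    ∇⨾Δ-entry p q = refl⟩⨾⟨ assoc ○ pullˡ p ○ idˡ ○ q

  [∇⨾Δ]₁₁ : [ ∇ {A} ⨾ Δ ]₁₁ ≈ id
  [∇⨾Δ]₁₁ = ∇⨾Δ-entry ι₁⨾∇ Δ⨾π₁

  [∇⨾Δ]₁₂ : [ ∇ {A} ⨾ Δ ]₁₂ ≈ id
  [∇⨾Δ]₁₂ = ∇⨾Δ-entry ι₁⨾∇ Δ⨾π₂

  [∇⨾Δ]₂₁ : [ ∇ {A} ⨾ Δ ]₂₁ ≈ id
  [∇⨾Δ]₂₁ = ∇⨾Δ-entry ι₂⨾∇ Δ⨾π₁

  [∇⨾Δ]₂₂ : [ ∇ {A} ⨾ Δ ]₂₂ ≈ id
  [∇⨾Δ]₂₂ = ∇⨾Δ-entry ι₂⨾∇ Δ⨾π₂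

  [⊕]₁₁ : {f : A ⇒ B} {g : C ⇒ D} → [ f ⊕₁ g ]₁₁ ≈ f
  [⊕]₁₁ = refl⟩⨾⟨ π₁-natural ○ sym-assoc ○ elimˡ ι₁⨾π₁

  [⊕]₁₂ : {f : A ⇒ B} {g : C ⇒ D} → [ f ⊕₁ g ]₁₂ ≈ 0ₕ
  [⊕]₁₂ = refl⟩⨾⟨ π₂-natural ○ sym-assoc ○ ι₁⨾π₂ ⟩⨾⟨refl ○ zeroˡ

  [⊕]₂₁ : {f : A ⇒ B} {g : C ⇒ D} → [ f ⊕₁ g ]₂₁ ≈ 0ₕ
  [⊕]₂₁ = refl⟩⨾⟨ π₁-natural ○ sym-assoc ○ ι₂⨾π₁ ⟩⨾⟨refl ○ zeroˡ

  [⊕]₂₂ : {f : A ⇒ B} {g : C ⇒ D} → [ f ⊕₁ g ]₂₂ ≈ g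
  [⊕]₂₂ = refl⟩⨾⟨ π₂-natural ○ sym-assoc ○ elimˡ ι₂⨾π₂

  π₁⨾-⨾ι₁ : {f : A ⇒ B} → π₁ {A} {C} ⨾ f ⨾ ι₁ {B} {D} ≈ f ⊕₁ 0ₕ
  π₁⨾-⨾ι₁ = pullˡ (sym≈ π₁-natural) ○ assoc ○ refl⟩⨾⟨ π₁⨾ι₁ ○ ⊕-homo′ ○ idʳ ⟩⊕⟨ zeroˡ

  module _ {K : S ⊕ X ⇒ T ⊕ Y} {Z : Obj} where
    [α⇐⨾-⊕id⨾α⇒]₁₁ : [ α⇐ ⨾ (K ⊕₁ id {Z}) ⨾ α⇒ ]₁₁ ≈ [ K ]₁₁
    [α⇐⨾-⊕id⨾α⇒]₁₁ = ⨾-sandwich ι₁⨾α⇐ α⇒⨾π₁ ○ assoc-sandwich ○ refl⟩⨾⟨ [⊕]₁₁ ⟩⨾⟨refl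

    [α⇐⨾-⊕id⨾α⇒]₁₂ : [ α⇐ ⨾ (K ⊕₁ id {Z}) ⨾ α⇒ ]₁₂ ≈ [ K ]₁₂ ⨾ ι₁
    [α⇐⨾-⊕id⨾α⇒]₁₂ = ⨾-sandwich ι₁⨾α⇐ α⇒⨾π₂ ○ assoc ○ refl⟩⨾⟨ (pullˡ ι₁-natural ○ assoc ○ refl⟩⨾⟨ ι₁-natural)
                   ○ refl⟩⨾⟨ sym-assoc ○ sym-assoc

    [α⇐⨾-⊕id⨾α⇒]₂₁ : [ α⇐ ⨾ (K ⊕₁ id {Z}) ⨾ α⇒ ]₂₁ ≈ π₁ ⨾ [ K ]₂₁
    [α⇐⨾-⊕id⨾α⇒]₂₁ = ⨾-sandwich ι₂⨾α⇐ α⇒⨾π₁ ○ pullˡ ⊕-homo′ ○ pullˡ π₁-natural ○ assoc ○ refl⟩⨾⟨ assoc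

    [α⇐⨾-⊕id⨾α⇒]₂₂ : [ α⇐ ⨾ (K ⊕₁ id {Z}) ⨾ α⇒ ]₂₂ ≈ [ K ]₂₂ ⊕₁ id
    [α⇐⨾-⊕id⨾α⇒]₂₂ = ⨾-sandwich ι₂⨾α⇐ α⇒⨾π₂ ○ refl⟩⨾⟨ ⊕-homo′ ○ ⊕-homo′ ○ refl⟩⊕⟨ (idˡ ○ idˡ)

  module _ {f : (S ⊕ T) ⊕ X ⇒ (S ⊕ T) ⊕ Y} where
    [α⇐⨾-⨾α⇒]₁₁ : [ α⇐ ⨾ f ⨾ α⇒ ]₁₁ ≈ [ [ f ]₁₁ ]₁₁
    [α⇐⨾-⨾α⇒]₁₁ = ⨾-sandwich ι₁⨾α⇐ α⇒⨾π₁ ○ assoc-sandwich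

    [α⇐⨾-⨾α⇒]₁₂⨾π₁ : [ α⇐ ⨾ f ⨾ α⇒ ]₁₂ ⨾ π₁ ≈ [ [ f ]₁₁ ]₁₂
    [α⇐⨾-⨾α⇒]₁₂⨾π₁ = assoc ○ refl⟩⨾⟨ assoc ○ ⨾-sandwich ι₁⨾α⇐ α⇒⨾π₂⨾π₁ ○ assoc-sandwich

    [α⇐⨾-⨾α⇒]₁₂⨾π₂ : [ α⇐ ⨾ f ⨾ α⇒ ]₁₂ ⨾ π₂ ≈ ι₁ ⨾ [ f ]₁₂
    [α⇐⨾-⨾α⇒]₁₂⨾π₂ = assoc ○ refl⟩⨾⟨ assoc ○ ⨾-sandwich ι₁⨾α⇐ α⇒⨾π₂⨾π₂ ○ assoc

    ι₁⨾[α⇐⨾-⨾α⇒]₂₁ : ι₁ ⨾ [ α⇐ ⨾ f ⨾ α⇒ ]₂₁ ≈ [ [ f ]₁₁ ]₂₁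
    ι₁⨾[α⇐⨾-⨾α⇒]₂₁ = sym-assoc ○ ⨾-sandwich ι₁⨾ι₂⨾α⇐ α⇒⨾π₁ ○ assoc-sandwich

    ι₂⨾[α⇐⨾-⨾α⇒]₂₁ : ι₂ ⨾ [ α⇐ ⨾ f ⨾ α⇒ ]₂₁ ≈ [ f ]₂₁ ⨾ π₁
    ι₂⨾[α⇐⨾-⨾α⇒]₂₁ = sym-assoc ○ ⨾-sandwich ι₂⨾ι₂⨾α⇐ α⇒⨾π₁ ○ refl⟩⨾⟨ sym-assoc ○ sym-assoc

    [[α⇐⨾-⨾α⇒]₂₂]₁₁ : [ [ α⇐ ⨾ f ⨾ α⇒ ]₂₂ ]₁₁ ≈ [ [ f ]₁₁ ]₂₂
    [[α⇐⨾-⨾α⇒]₂₂]₁₁ = sym≈ assoc-sandwich ○ ⨾-sandwich ι₁⨾ι₂⨾α⇐ α⇒⨾π₂⨾π₁ ○ assoc-sandwich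

    [[α⇐⨾-⨾α⇒]₂₂]₁₂ : [ [ α⇐ ⨾ f ⨾ α⇒ ]₂₂ ]₁₂ ≈ ι₂ ⨾ [ f ]₁₂
    [[α⇐⨾-⨾α⇒]₂₂]₁₂ = sym≈ assoc-sandwich ○ ⨾-sandwich ι₁⨾ι₂⨾α⇐ α⇒⨾π₂⨾π₂ ○ assoc

    [[α⇐⨾-⨾α⇒]₂₂]₂₁ : [ [ α⇐ ⨾ f ⨾ α⇒ ]₂₂ ]₂₁ ≈ [ f ]₂₁ ⨾ π₂
    [[α⇐⨾-⨾α⇒]₂₂]₂₁ = sym≈ assoc-sandwich ○ ⨾-sandwich ι₂⨾ι₂⨾α⇐ α⇒⨾π₂⨾π₁ ○ refl⟩⨾⟨ sym-assoc ○ sym-assoc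

    [[α⇐⨾-⨾α⇒]₂₂]₂₂ : [ [ α⇐ ⨾ f ⨾ α⇒ ]₂₂ ]₂₂ ≈ [ f ]₂₂
    [[α⇐⨾-⨾α⇒]₂₂]₂₂ = sym≈ assoc-sandwich ○ ⨾-sandwich ι₂⨾ι₂⨾α⇐ α⇒⨾π₂⨾π₂

  matrix-product : ∀ {A B C D S X} {u : A ⇒ B} {f : B ⇒ S ⊕ X} {g : S ⊕ X ⇒ C} {v : C ⇒ D} →
                   u ⨾ (f ⨾ g) ⨾ v ≈ (u ⨾ f ⨾ π₁) ⨾ (ι₁ ⨾ g ⨾ v) + (u ⨾ f ⨾ π₂) ⨾ (ι₂ ⨾ g ⨾ v)
  matrix-product {S = S} {X} =
    refl⟩⨾⟨ (refl⟩⨾⟨ introˡ (π⨾ι-sum {S} {X}) ○ refl⟩⨾⟨ ⨾-distribʳ-+ ○ ⨾-distribˡ-+) ⟩⨾⟨refl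
    ○ ⨾-distrib-+ ○ regroup ⟩+⟨ regroup
    where
    regroup : ∀ {P Q R U V W} {u : P ⇒ Q} {f : Q ⇒ R} {p : R ⇒ U} {i : U ⇒ R} {g : R ⇒ V} {v : V ⇒ W} →
              u ⨾ (f ⨾ (p ⨾ i) ⨾ g) ⨾ v ≈ (u ⨾ f ⨾ p) ⨾ (i ⨾ g ⨾ v)
    regroup = refl⟩⨾⟨ (refl⟩⨾⟨ assoc) ⟩⨾⟨refl ○ sym≈ assoc-sandwich ○ sym-assoc ○ assoc ⟩⨾⟨ assoc

  [id]₁₁ : [ id {A ⊕ B} ]₁₁ ≈ id
  [id]₁₁ = refl⟩⨾⟨ idˡ ○ ι₁⨾π₁

  [id]₁₂ : [ id {A ⊕ B} ]₁₂ ≈ 0ₕ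
  [id]₁₂ = refl⟩⨾⟨ idˡ ○ ι₁⨾π₂

  [id]₂₁ : [ id {A ⊕ B} ]₂₁ ≈ 0ₕ
  [id]₂₁ = refl⟩⨾⟨ idˡ ○ ι₂⨾π₁

  [id]₂₂ : [ id {A ⊕ B} ]₂₂ ≈ id
  [id]₂₂ = refl⟩⨾⟨ idˡ ○ ι₂⨾π₂

  module Conway (s : ∀ {A} → A ⇒ A → A ⇒ A) (s-cong : ∀ {A} {f g : A ⇒ A} → f ≈ g → s f ≈ s g) where

    conway : S ⊕ X ⇒ S ⊕ Y → X ⇒ Y
    conway f = [ f ]₂₂ + [ f ]₂₁ ⨾ s [ f ]₁₁ ⨾ [ f ]₁₂

    conway-by : {f : S ⊕ X ⇒ S ⊕ Y} {a : S ⇒ S} {b : S ⇒ Y} {c : X ⇒ S} {d : X ⇒ Y} →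
                [ f ]₁₁ ≈ a → [ f ]₁₂ ≈ b → [ f ]₂₁ ≈ c → [ f ]₂₂ ≈ d → conway f ≈ d + c ⨾ s a ⨾ b
    conway-by p q r t = t ⟩+⟨ r ⟩⨾⟨ s-cong p ⟩⨾⟨ q

    conway-cong : {f g : S ⊕ X ⇒ S ⊕ Y} → f ≈ g → conway f ≈ conway g
    conway-cong p = conway-by (inner-cong p) (inner-cong p) (inner-cong p) (inner-cong p)

    conway-sandwich : {f : S ⊕ X ⇒ S ⊕ Y} {u : A ⇒ X} {v : Y ⇒ B} →
                      u ⨾ conway f ⨾ v ≈ u ⨾ [ f ]₂₂ ⨾ v + (u ⨾ [ f ]₂₁) ⨾ s [ f ]₁₁ ⨾ ([ f ]₁₂ ⨾ v)
    conway-sandwich = ⨾-distrib-+ ○ refl⟩+⟨ sym≈ assoc-sandwich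

    -- Conway's formula for the star of a 2×2 block matrix, written as a diagonal term plus
    -- column ⨾ (Schur complement)* ⨾ row so that it can be pre- and post-composed termwise.
    blockStar : S ⊕ T ⇒ S ⊕ T → S ⊕ T ⇒ S ⊕ T
    blockStar M = π₁ ⨾ s [ M ]₁₁ ⨾ ι₁
                + (π₂ + π₁ ⨾ s [ M ]₁₁ ⨾ [ M ]₁₂) ⨾ s (conway M) ⨾ (ι₂ + [ M ]₂₁ ⨾ s [ M ]₁₁ ⨾ ι₁)

    blockStar-cong : {M N : S ⊕ T ⇒ S ⊕ T} → M ≈ N → blockStar M ≈ blockStar N
    blockStar-cong {M = M} {N} p =
      inner-cong a* ⟩+⟨ (refl⟩+⟨ refl⟩⨾⟨ a* ⟩⨾⟨ inner-cong p) ⟩⨾⟨ s-cong (conway-cong p)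
                     ⟩⨾⟨ (refl⟩+⟨ inner-cong p ⟩⨾⟨ a* ⟩⨾⟨refl)
      where
      a* : s [ M ]₁₁ ≈ s [ N ]₁₁
      a* = s-cong (inner-cong p)

    module _ {M : S ⊕ T ⇒ S ⊕ T} where
      private
        a* : S ⇒ S
        a* = s [ M ]₁₁
        b : S ⇒ T
        b = [ M ]₁₂
        c : T ⇒ S
        c = [ M ]₂₁
        G : T ⇒ T
        G = s (conway M)

        split : {u : A ⇒ S ⊕ T} {v : S ⊕ T ⇒ B} →
                u ⨾ blockStar M ⨾ v ≈ u ⨾ (π₁ ⨾ a* ⨾ ι₁) ⨾ v
                                    + (u ⨾ (π₂ + π₁ ⨾ a* ⨾ b)) ⨾ G ⨾ ((ι₂ + c ⨾ a* ⨾ ι₁) ⨾ v)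
        split = ⨾-distrib-+ ○ refl⟩+⟨ sym≈ assoc-sandwich

        ι₁⨾column : ι₁ ⨾ (π₂ + π₁ ⨾ a* ⨾ b) ≈ a* ⨾ b
        ι₁⨾column = ⨾-distribˡ-+ ○ ι₁⨾π₂ ⟩+⟨ cancelˡ ι₁⨾π₁ ○ +-identityˡ

        ι₂⨾column : ι₂ ⨾ (π₂ + π₁ ⨾ a* ⨾ b) ≈ id
        ι₂⨾column = ⨾-distribˡ-+ ○ ι₂⨾π₂ ⟩+⟨ (pullˡ ι₂⨾π₁ ○ zeroˡ) ○ +-identityʳ

        row⨾π₁ : (ι₂ + c ⨾ a* ⨾ ι₁) ⨾ π₁ ≈ c ⨾ a*
        row⨾π₁ = ⨾-distribʳ-+ ○ ι₂⨾π₁ ⟩+⟨ (assoc ○ refl⟩⨾⟨ (assoc ○ elimʳ ι₁⨾π₁)) ○ +-identityˡ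

        row⨾π₂ : (ι₂ + c ⨾ a* ⨾ ι₁) ⨾ π₂ ≈ id
        row⨾π₂ = ⨾-distribʳ-+ ○ ι₂⨾π₂ ⟩+⟨ (assoc ○ refl⟩⨾⟨ (assoc ○ refl⟩⨾⟨ ι₁⨾π₂ ○ zeroʳ) ○ zeroʳ)
               ○ +-identityʳ

      [blockStar]₁₁ : [ blockStar M ]₁₁ ≈ a* + a* ⨾ b ⨾ G ⨾ c ⨾ a*
      [blockStar]₁₁ = split ○ sandwich-cancel ι₁⨾π₁ ι₁⨾π₁ ⟩+⟨ (ι₁⨾column ⟩⨾⟨ refl⟩⨾⟨ row⨾π₁ ○ assoc)

      [blockStar]₁₂ : [ blockStar M ]₁₂ ≈ a* ⨾ b ⨾ G
      [blockStar]₁₂ = split ○ sandwich-zeroʳ ι₁⨾π₂ ⟩+⟨ (ι₁⨾column ⟩⨾⟨ refl⟩⨾⟨ row⨾π₂ ○ assoc ○ refl⟩⨾⟨ refl⟩⨾⟨ idʳ)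
                    ○ +-identityˡ

      [blockStar]₂₁ : [ blockStar M ]₂₁ ≈ G ⨾ c ⨾ a*
      [blockStar]₂₁ = split ○ sandwich-zeroˡ ι₂⨾π₁ ⟩+⟨ (ι₂⨾column ⟩⨾⟨ refl⟩⨾⟨ row⨾π₁ ○ idˡ)
                    ○ +-identityˡ

      [blockStar]₂₂ : [ blockStar M ]₂₂ ≈ G
      [blockStar]₂₂ = split ○ sandwich-zeroˡ ι₂⨾π₁ ⟩+⟨ (ι₂⨾column ⟩⨾⟨ refl⟩⨾⟨ row⨾π₂ ○ idˡ ○ idʳ)
                    ○ +-identityˡ

    conway-nested : ∀ {S T X Y} {f : (S ⊕ T) ⊕ X ⇒ (S ⊕ T) ⊕ Y} →
                    conway (conway (α⇐ ⨾ f ⨾ α⇒)) ≈ [ f ]₂₂ + [ f ]₂₁ ⨾ blockStar [ f ]₁₁ ⨾ [ f ]₁₂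
    conway-nested {S} {T} {X} {Y} {f} =
      conway-by h₁₁ h₁₂ h₂₁ h₂₂ ○ +-assoc ○ refl⟩+⟨ sym≈ (⨾-distrib-+ ○ corner ⟩+⟨ border)
      where
      M : S ⊕ T ⇒ S ⊕ T
      M = [ f ]₁₁
      B′ : S ⊕ T ⇒ Y
      B′ = [ f ]₁₂
      C′ : X ⇒ S ⊕ T
      C′ = [ f ]₂₁
      D′ : X ⇒ Y
      D′ = [ f ]₂₂
      a* : S ⇒ S
      a* = s [ M ]₁₁
      g : S ⊕ (T ⊕ X) ⇒ S ⊕ (T ⊕ Y)
      g = α⇐ ⨾ f ⨾ α⇒

      h₁₁ : [ conway g ]₁₁ ≈ conway M
      h₁₁ = conway-sandwich ○ [[α⇐⨾-⨾α⇒]₂₂]₁₁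
          ⟩+⟨ ι₁⨾[α⇐⨾-⨾α⇒]₂₁ ⟩⨾⟨ s-cong [α⇐⨾-⨾α⇒]₁₁ ⟩⨾⟨ [α⇐⨾-⨾α⇒]₁₂⨾π₁
      h₁₂ : [ conway g ]₁₂ ≈ ι₂ ⨾ B′ + [ M ]₂₁ ⨾ a* ⨾ ι₁ ⨾ B′
      h₁₂ = conway-sandwich ○ [[α⇐⨾-⨾α⇒]₂₂]₁₂
          ⟩+⟨ ι₁⨾[α⇐⨾-⨾α⇒]₂₁ ⟩⨾⟨ s-cong [α⇐⨾-⨾α⇒]₁₁ ⟩⨾⟨ [α⇐⨾-⨾α⇒]₁₂⨾π₂
      h₂₁ : [ conway g ]₂₁ ≈ C′ ⨾ π₂ + C′ ⨾ π₁ ⨾ a* ⨾ [ M ]₁₂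
      h₂₁ = conway-sandwich ○ [[α⇐⨾-⨾α⇒]₂₂]₂₁
          ⟩+⟨ (ι₂⨾[α⇐⨾-⨾α⇒]₂₁ ⟩⨾⟨ s-cong [α⇐⨾-⨾α⇒]₁₁ ⟩⨾⟨ [α⇐⨾-⨾α⇒]₁₂⨾π₁ ○ assoc)
      h₂₂ : [ conway g ]₂₂ ≈ D′ + C′ ⨾ π₁ ⨾ a* ⨾ ι₁ ⨾ B′
      h₂₂ = conway-sandwich ○ [[α⇐⨾-⨾α⇒]₂₂]₂₂
          ⟩+⟨ (ι₂⨾[α⇐⨾-⨾α⇒]₂₁ ⟩⨾⟨ s-cong [α⇐⨾-⨾α⇒]₁₁ ⟩⨾⟨ [α⇐⨾-⨾α⇒]₁₂⨾π₂ ○ assoc)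

      corner : C′ ⨾ (π₁ ⨾ a* ⨾ ι₁) ⨾ B′ ≈ C′ ⨾ π₁ ⨾ a* ⨾ ι₁ ⨾ B′
      corner = refl⟩⨾⟨ (assoc ○ refl⟩⨾⟨ assoc)
      border : C′ ⨾ ((π₂ + π₁ ⨾ a* ⨾ [ M ]₁₂) ⨾ s (conway M) ⨾ (ι₂ + [ M ]₂₁ ⨾ a* ⨾ ι₁)) ⨾ B′
             ≈ (C′ ⨾ π₂ + C′ ⨾ π₁ ⨾ a* ⨾ [ M ]₁₂) ⨾ s (conway M) ⨾ (ι₂ ⨾ B′ + [ M ]₂₁ ⨾ a* ⨾ ι₁ ⨾ B′)
      border = sym≈ assoc-sandwich ○ ⨾-distribˡ-+ ⟩⨾⟨ refl⟩⨾⟨ (⨾-distribʳ-+ ○ refl⟩+⟨ (assoc ○ refl⟩⨾⟨ assoc))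

module KleeneAlgebra {o ℓ e r} {𝒞 : SymMonPosCat o ℓ e r} {𝔅 : FinBiprodIdemConv 𝒞} (KS : KleeneStar 𝔅) where
  open Matrices 𝔅 public
  open KleeneStar KS public

  private variable
    A B S T : Obj

  id≤* : {f : A ⇒ A} → id ≤ f *
  id≤* = x≤x+y ○≤ star-unfoldˡ

  f⨾f*≤f* : {f : A ⇒ A} → f ⨾ f * ≤ f *
  f⨾f*≤f* = y≤x+y ○≤ star-unfoldˡ

  f*⨾f≤f* : {f : A ⇒ A} → f * ⨾ f ≤ f *
  f*⨾f≤f* = y≤x+y ○≤ star-unfoldʳ

  x≤f*⨾x : {f : A ⇒ A} {x : A ⇒ B} → x ≤ f * ⨾ x
  x≤f*⨾x = ≈⇒≥ idˡ ○≤ ⨾-monoˡ id≤*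

  x≤x⨾f* : {f : A ⇒ A} {x : B ⇒ A} → x ≤ x ⨾ f *
  x≤x⨾f* = ≈⇒≥ idʳ ○≤ ⨾-monoʳ id≤*

  *-least : {f : A ⇒ A} {b y : A ⇒ B} → b + f ⨾ y ≤ y → f * ⨾ b ≤ y
  *-least p = ⨾-monoʳ (x≤x+y ○≤ p) ○≤ star-indʳ (y≤x+y ○≤ p)

  *-leastʳ : {f : A ⇒ A} {b y : B ⇒ A} → b + y ⨾ f ≤ y → b ⨾ f * ≤ y
  *-leastʳ p = ⨾-monoˡ (x≤x+y ○≤ p) ○≤ star-indˡ (y≤x+y ○≤ p)

  *-least-id : {f y : A ⇒ A} → id + f ⨾ y ≤ y → f * ≤ y
  *-least-id p = ≈⇒≥ idʳ ○≤ *-least p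

  *-mono : {f g : A ⇒ A} → f ≤ g → f * ≤ g *
  *-mono p = *-least-id (+-lub id≤* (⨾-monoˡ p ○≤ f⨾f*≤f*))

  *-cong : {f g : A ⇒ A} → f ≈ g → f * ≈ g *
  *-cong p = ≤-antisym (*-mono (≈⇒≤ p)) (*-mono (≈⇒≥ p))

  0ₕ*≈id : 0ₕ * ≈ id {A}
  0ₕ*≈id = ≤-antisym (*-least-id (+-lub ≤-refl (≈⇒≤ idʳ ○≤ 0ₕ≤))) id≤*

  id*≤id : id * ≤ id {A}
  id*≤id = *-least-id (≈⇒≤ (refl⟩+⟨ idˡ ○ +-idem))

  *-slide : {f : A ⇒ B} {g : B ⇒ A} → g ⨾ (f ⨾ g) * ≈ (g ⨾ f) * ⨾ g
  *-slide = ≤-antisym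
    (*-leastʳ (+-lub x≤f*⨾x (≈⇒≤ (assoc ○ refl⟩⨾⟨ sym-assoc ○ sym-assoc) ○≤ ⨾-monoˡ f*⨾f≤f*)))
    (*-least (+-lub x≤x⨾f* (≈⇒≤ (assoc ○ refl⟩⨾⟨ sym-assoc) ○≤ ⨾-monoʳ f⨾f*≤f*)))

  *-simulationˡ : {f : A ⇒ A} {g : B ⇒ B} {r : A ⇒ B} → f ⨾ r ≤ r ⨾ g → f * ⨾ r ≤ r ⨾ g *
  *-simulationˡ p = *-least (+-lub x≤x⨾f* (≈⇒≤ sym-assoc ○≤ ⨾-monoˡ p ○≤ ≈⇒≤ assoc ○≤ ⨾-monoʳ f⨾f*≤f*))

  *-simulationʳ : {f : A ⇒ A} {g : B ⇒ B} {r : B ⇒ A} → r ⨾ f ≤ g ⨾ r → r ⨾ f * ≤ g * ⨾ r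
  *-simulationʳ p = *-leastʳ (+-lub x≤f*⨾x (≈⇒≤ assoc ○≤ ⨾-monoʳ p ○≤ ≈⇒≤ sym-assoc ○≤ ⨾-monoˡ f*⨾f≤f*))

  open Conway _* *-cong public

  module _ {M : S ⊕ T ⇒ S ⊕ T} where
    private
      a : S ⇒ S
      a = [ M ]₁₁
      b : S ⇒ T
      b = [ M ]₁₂
      c : T ⇒ S
      c = [ M ]₂₁
      d : T ⇒ T
      d = [ M ]₂₂
      G : T ⇒ T
      G = conway M *

      module Unfold (X : S ⊕ T ⇒ S ⊕ T) where
        [unfold]₁₁ : [ id + M ⨾ X ]₁₁ ≈ id + (a ⨾ [ X ]₁₁ + b ⨾ [ X ]₂₁)
        [unfold]₁₁ = ⨾-distrib-+ ○ [id]₁₁ ⟩+⟨ matrix-product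
        [unfold]₁₂ : [ id + M ⨾ X ]₁₂ ≈ 0ₕ + (a ⨾ [ X ]₁₂ + b ⨾ [ X ]₂₂)
        [unfold]₁₂ = ⨾-distrib-+ ○ [id]₁₂ ⟩+⟨ matrix-product
        [unfold]₂₁ : [ id + M ⨾ X ]₂₁ ≈ 0ₕ + (c ⨾ [ X ]₁₁ + d ⨾ [ X ]₂₁)
        [unfold]₂₁ = ⨾-distrib-+ ○ [id]₂₁ ⟩+⟨ matrix-product
        [unfold]₂₂ : [ id + M ⨾ X ]₂₂ ≈ id + (c ⨾ [ X ]₁₂ + d ⨾ [ X ]₂₂)
        [unfold]₂₂ = ⨾-distrib-+ ○ [id]₂₂ ⟩+⟨ matrix-product

      d⨾G≤G : d ⨾ G ≤ G
      d⨾G≤G = ⨾-monoˡ x≤x+y ○≤ f⨾f*≤f*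

      ca*b⨾G≤G : (c ⨾ a * ⨾ b) ⨾ G ≤ G
      ca*b⨾G≤G = ⨾-monoˡ y≤x+y ○≤ f⨾f*≤f*

    star≤blockStar : M * ≤ blockStar M
    star≤blockStar = *-least-id (entrywise-≤
      (≈⇒≤ ([unfold]₁₁ ○ refl⟩+⟨ (entries₁₁ ⟩+⟨ entries₂₁)) ○≤ prefix₁₁ ○≤ ≈⇒≥ [blockStar]₁₁)
      (≈⇒≤ ([unfold]₁₂ ○ refl⟩+⟨ (entries₁₂ ⟩+⟨ entries₂₂)) ○≤ prefix₁₂ ○≤ ≈⇒≥ [blockStar]₁₂)
      (≈⇒≤ ([unfold]₂₁ ○ refl⟩+⟨ (entries₁₁ ⟩+⟨ entries₂₁)) ○≤ prefix₂₁ ○≤ ≈⇒≥ [blockStar]₂₁)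
      (≈⇒≤ ([unfold]₂₂ ○ refl⟩+⟨ (entries₁₂ ⟩+⟨ entries₂₂)) ○≤ prefix₂₂ ○≤ ≈⇒≥ [blockStar]₂₂))
      where
      open Unfold (blockStar M)
      entries₁₁ : {x : A ⇒ S} → x ⨾ [ blockStar M ]₁₁ ≈ x ⨾ (a * + a * ⨾ b ⨾ G ⨾ c ⨾ a *)
      entries₁₁ = refl⟩⨾⟨ [blockStar]₁₁
      entries₁₂ : {x : A ⇒ S} → x ⨾ [ blockStar M ]₁₂ ≈ x ⨾ a * ⨾ b ⨾ G
      entries₁₂ = refl⟩⨾⟨ [blockStar]₁₂
      entries₂₁ : {x : A ⇒ T} → x ⨾ [ blockStar M ]₂₁ ≈ x ⨾ G ⨾ c ⨾ a *
      entries₂₁ = refl⟩⨾⟨ [blockStar]₂₁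
      entries₂₂ : {x : A ⇒ T} → x ⨾ [ blockStar M ]₂₂ ≈ x ⨾ G
      entries₂₂ = refl⟩⨾⟨ [blockStar]₂₂
      prefix₁₁ : id + (a ⨾ (a * + a * ⨾ b ⨾ G ⨾ c ⨾ a *) + b ⨾ G ⨾ c ⨾ a *) ≤ a * + a * ⨾ b ⨾ G ⨾ c ⨾ a *
      prefix₁₁ = +-lub (id≤* ○≤ x≤x+y)
                       (+-lub (≈⇒≤ ⨾-distribˡ-+ ○≤ +-mono f⨾f*≤f* (pullˡ-≤ f⨾f*≤f*)) (x≤f*⨾x ○≤ y≤x+y))
      prefix₁₂ : 0ₕ + (a ⨾ a * ⨾ b ⨾ G + b ⨾ G) ≤ a * ⨾ b ⨾ G
      prefix₁₂ = +-lub 0ₕ≤ (+-lub (pullˡ-≤ f⨾f*≤f*) x≤f*⨾x)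
      prefix₂₁ : 0ₕ + (c ⨾ (a * + a * ⨾ b ⨾ G ⨾ c ⨾ a *) + d ⨾ G ⨾ c ⨾ a *) ≤ G ⨾ c ⨾ a *
      prefix₂₁ = +-lub 0ₕ≤ (+-lub (≈⇒≤ ⨾-distribˡ-+ ○≤ +-lub x≤f*⨾x loop) (pullˡ-≤ d⨾G≤G))
        where
        loop : c ⨾ a * ⨾ b ⨾ G ⨾ c ⨾ a * ≤ G ⨾ c ⨾ a *
        loop = ≈⇒≤ (refl⟩⨾⟨ sym-assoc ○ sym-assoc) ○≤ pullˡ-≤ ca*b⨾G≤G
      prefix₂₂ : id + (c ⨾ a * ⨾ b ⨾ G + d ⨾ G) ≤ G
      prefix₂₂ = +-lub id≤* (+-lub (≈⇒≤ (refl⟩⨾⟨ sym-assoc ○ sym-assoc) ○≤ ca*b⨾G≤G) d⨾G≤G)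

    blockStar≤star : blockStar M ≤ M *
    blockStar≤star = entrywise-≤
      (≈⇒≤ [blockStar]₁₁ ○≤ +-lub a*≤e₁₁ (⨾-monoʳ (⨾-monoʳ (⨾-monoʳ c⨾a*≤e₂₁ ○≤ G⨾e₂₁≤e₂₁)) ○≤ a*⨾b⨾e₂₁≤e₁₁))
      (≈⇒≤ [blockStar]₁₂ ○≤ ⨾-monoʳ (⨾-monoʳ G≤e₂₂) ○≤ a*⨾b⨾e₂₂≤e₁₂)
      (≈⇒≤ [blockStar]₂₁ ○≤ ⨾-monoʳ c⨾a*≤e₂₁ ○≤ G⨾e₂₁≤e₂₁)
      (≈⇒≤ [blockStar]₂₂ ○≤ G≤e₂₂)
      where
      open Unfold (M *)
      e₁₁ : S ⇒ S
      e₁₁ = [ M * ]₁₁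
      e₁₂ : S ⇒ T
      e₁₂ = [ M * ]₁₂
      e₂₁ : T ⇒ S
      e₂₁ = [ M * ]₂₁
      e₂₂ : T ⇒ T
      e₂₂ = [ M * ]₂₂
      unfold₁₁ : id + (a ⨾ e₁₁ + b ⨾ e₂₁) ≤ e₁₁
      unfold₁₁ = ≈⇒≥ [unfold]₁₁ ○≤ inner-mono star-unfoldˡ
      unfold₁₂ : 0ₕ + (a ⨾ e₁₂ + b ⨾ e₂₂) ≤ e₁₂
      unfold₁₂ = ≈⇒≥ [unfold]₁₂ ○≤ inner-mono star-unfoldˡ
      unfold₂₁ : 0ₕ + (c ⨾ e₁₁ + d ⨾ e₂₁) ≤ e₂₁
      unfold₂₁ = ≈⇒≥ [unfold]₂₁ ○≤ inner-mono star-unfoldˡ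
      unfold₂₂ : id + (c ⨾ e₁₂ + d ⨾ e₂₂) ≤ e₂₂
      unfold₂₂ = ≈⇒≥ [unfold]₂₂ ○≤ inner-mono star-unfoldˡ

      a*≤e₁₁ : a * ≤ e₁₁
      a*≤e₁₁ = *-least-id (+-mono ≤-refl x≤x+y ○≤ unfold₁₁)
      a*⨾b⨾e₂₁≤e₁₁ : a * ⨾ b ⨾ e₂₁ ≤ e₁₁
      a*⨾b⨾e₂₁≤e₁₁ = *-least (+-lub (y≤x+y ○≤ y≤x+y) (x≤x+y ○≤ y≤x+y) ○≤ unfold₁₁)
      a*⨾b⨾e₂₂≤e₁₂ : a * ⨾ b ⨾ e₂₂ ≤ e₁₂
      a*⨾b⨾e₂₂≤e₁₂ = *-least (+-lub (y≤x+y ○≤ y≤x+y) (x≤x+y ○≤ y≤x+y) ○≤ unfold₁₂)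
      c⨾a*≤e₂₁ : c ⨾ a * ≤ e₂₁
      c⨾a*≤e₂₁ = ⨾-monoʳ a*≤e₁₁ ○≤ x≤x+y ○≤ y≤x+y ○≤ unfold₂₁
      G≤e₂₂ : G ≤ e₂₂
      G≤e₂₂ = *-least-id (+-mono ≤-refl (≈⇒≤ ⨾-distribʳ-+ ○≤ +-lub y≤x+y detour) ○≤ unfold₂₂)
        where
        detour : (c ⨾ a * ⨾ b) ⨾ e₂₂ ≤ c ⨾ e₁₂ + d ⨾ e₂₂
        detour = ≈⇒≤ (assoc ○ refl⟩⨾⟨ assoc) ○≤ ⨾-monoʳ a*⨾b⨾e₂₂≤e₁₂ ○≤ x≤x+y
      G⨾e₂₁≤e₂₁ : G ⨾ e₂₁ ≤ e₂₁
      G⨾e₂₁≤e₂₁ = *-least (+-lub ≤-refl (≈⇒≤ ⨾-distribʳ-+ ○≤ +-lub (y≤x+y ○≤ y≤x+y ○≤ unfold₂₁) detour))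
        where
        detour : (c ⨾ a * ⨾ b) ⨾ e₂₁ ≤ e₂₁
        detour = ≈⇒≤ (assoc ○ refl⟩⨾⟨ assoc) ○≤ ⨾-monoʳ a*⨾b⨾e₂₁≤e₁₁ ○≤ x≤x+y ○≤ y≤x+y ○≤ unfold₂₁

    *-blockStar : M * ≈ blockStar M
    *-blockStar = ≤-antisym star≤blockStar blockStar≤star

module StarToTrace {o ℓ e r} {𝒞 : SymMonPosCat o ℓ e r} {𝔅 : FinBiprodIdemConv 𝒞} (KS : KleeneStar 𝔅) where
  open KleeneAlgebra KS

  private variable
    A S T X X′ Y Y′ Z : Obj

  conway-tightening : {f : S ⊕ X ⇒ S ⊕ Y} {g : X′ ⇒ X} {h : Y ⇒ Y′} →
                      conway ((id {S} ⊕₁ g) ⨾ f ⨾ (id ⊕₁ h)) ≈ g ⨾ conway f ⨾ h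
  conway-tightening = conway-by ([⊕⨾-⨾⊕]₁₁ ○ idˡ ○ idʳ) ([⊕⨾-⨾⊕]₁₂ ○ idˡ) ([⊕⨾-⨾⊕]₂₁ ○ refl⟩⨾⟨ idʳ) [⊕⨾-⨾⊕]₂₂
                    ○ sym≈ conway-sandwich

  conway-strength : {f : S ⊕ X ⇒ S ⊕ Y} →
                    conway (α⇐ ⨾ (f ⊕₁ id {Z}) ⨾ α⇒) ≈ conway f ⊕₁ id
  conway-strength =
    conway-by [α⇐⨾-⊕id⨾α⇒]₁₁ [α⇐⨾-⊕id⨾α⇒]₁₂ [α⇐⨾-⊕id⨾α⇒]₂₁ [α⇐⨾-⊕id⨾α⇒]₂₂
    ○ refl⟩+⟨ (assoc-sandwich ○ π₁⨾-⨾ι₁) ○ ⊕-+-interchange ○ refl⟩⊕⟨ +-identityʳ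

  conway-joining : {f : (S ⊕ T) ⊕ X ⇒ (S ⊕ T) ⊕ Y} → conway f ≈ conway (conway (α⇐ ⨾ f ⨾ α⇒))
  conway-joining = refl⟩+⟨ refl⟩⨾⟨ *-blockStar ⟩⨾⟨refl ○ sym≈ conway-nested

  conway-vanishing : {f : 𝟎 ⊕ X ⇒ 𝟎 ⊕ Y} → conway f ≈ λ⇐ ⨾ f ⨾ λ⇒
  conway-vanishing = refl⟩+⟨ through-𝟎 _ _ ○ +-identityʳ ○ ι₂≈λ⇐ ⟩⨾⟨ refl⟩⨾⟨ π₂≈λ⇒

  conway-sliding : {f : S ⊕ X ⇒ T ⊕ Y} {g : T ⇒ S} →
                   conway (f ⨾ (g ⊕₁ id)) ≈ conway ((g ⊕₁ id) ⨾ f)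
  conway-sliding = conway-by [-⨾⊕]₁₁ ([-⨾⊕]₁₂ ○ idʳ) [-⨾⊕]₂₁ ([-⨾⊕]₂₂ ○ idʳ)
                 ○ refl⟩+⟨ (assoc ○ refl⟩⨾⟨ (sym-assoc ○ *-slide ⟩⨾⟨refl ○ assoc))
                 ○ sym≈ (conway-by [⊕⨾-]₁₁ [⊕⨾-]₁₂ ([⊕⨾-]₂₁ ○ idˡ) ([⊕⨾-]₂₂ ○ idˡ))

  conway-yanking : conway (σ {A} {A}) ≈ id
  conway-yanking = conway-by [σ]₁₁ [σ]₁₂ [σ]₂₁ [σ]₂₂ ○ +-identityˡ ○ idˡ ○ idʳ ○ 0ₕ*≈id

  conway-AU1 : {f : S ⊕ X ⇒ S ⊕ Y} {g : T ⊕ X ⇒ T ⊕ Y} (r : S ⇒ T) →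
               f ⨾ (r ⊕₁ id) ≤ (r ⊕₁ id) ⨾ g → conway f ≤ conway g
  conway-AU1 {f = f} {g} r p = +-mono sim₂₂ (⨾-monoʳ (⨾-monoʳ sim₁₂) ○≤ ≈⇒≤ (refl⟩⨾⟨ sym-assoc)
    ○≤ ⨾-monoʳ (⨾-monoˡ (*-simulationˡ sim₁₁)) ○≤ ≈⇒≤ (refl⟩⨾⟨ assoc ○ sym-assoc) ○≤ ⨾-monoˡ sim₂₁)
    where
    sim₁₁ : [ f ]₁₁ ⨾ r ≤ r ⨾ [ g ]₁₁
    sim₁₁ = ≈⇒≥ [-⨾⊕]₁₁ ○≤ inner-mono p ○≤ ≈⇒≤ [⊕⨾-]₁₁
    sim₁₂ : [ f ]₁₂ ≤ r ⨾ [ g ]₁₂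
    sim₁₂ = ≈⇒≥ ([-⨾⊕]₁₂ ○ idʳ) ○≤ inner-mono p ○≤ ≈⇒≤ [⊕⨾-]₁₂
    sim₂₁ : [ f ]₂₁ ⨾ r ≤ [ g ]₂₁
    sim₂₁ = ≈⇒≥ [-⨾⊕]₂₁ ○≤ inner-mono p ○≤ ≈⇒≤ ([⊕⨾-]₂₁ ○ idˡ)
    sim₂₂ : [ f ]₂₂ ≤ [ g ]₂₂
    sim₂₂ = ≈⇒≥ ([-⨾⊕]₂₂ ○ idʳ) ○≤ inner-mono p ○≤ ≈⇒≤ ([⊕⨾-]₂₂ ○ idˡ)

  conway-AU2 : {f : S ⊕ X ⇒ S ⊕ Y} {g : T ⊕ X ⇒ T ⊕ Y} (r : T ⇒ S) →
               (r ⊕₁ id) ⨾ f ≤ g ⨾ (r ⊕₁ id) → conway f ≤ conway g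
  conway-AU2 {f = f} {g} r p = +-mono sim₂₂ (⨾-monoˡ sim₂₁ ○≤ ≈⇒≤ (assoc ○ refl⟩⨾⟨ sym-assoc)
    ○≤ ⨾-monoʳ (⨾-monoˡ (*-simulationʳ sim₁₁)) ○≤ ≈⇒≤ (refl⟩⨾⟨ assoc) ○≤ ⨾-monoʳ (⨾-monoʳ sim₁₂))
    where
    sim₁₁ : r ⨾ [ f ]₁₁ ≤ [ g ]₁₁ ⨾ r
    sim₁₁ = ≈⇒≥ [⊕⨾-]₁₁ ○≤ inner-mono p ○≤ ≈⇒≤ [-⨾⊕]₁₁
    sim₁₂ : r ⨾ [ f ]₁₂ ≤ [ g ]₁₂
    sim₁₂ = ≈⇒≥ [⊕⨾-]₁₂ ○≤ inner-mono p ○≤ ≈⇒≤ ([-⨾⊕]₁₂ ○ idʳ)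
    sim₂₁ : [ f ]₂₁ ≤ [ g ]₂₁ ⨾ r
    sim₂₁ = ≈⇒≥ ([⊕⨾-]₂₁ ○ idˡ) ○≤ inner-mono p ○≤ ≈⇒≤ [-⨾⊕]₂₁
    sim₂₂ : [ f ]₂₂ ≤ [ g ]₂₂
    sim₂₂ = ≈⇒≥ ([⊕⨾-]₂₂ ○ idˡ) ○≤ inner-mono p ○≤ ≈⇒≤ ([-⨾⊕]₂₂ ○ idʳ)

  conway-AT1 : conway (∇ {A} ⨾ Δ) ≤ id
  conway-AT1 = ≈⇒≤ (conway-by [∇⨾Δ]₁₁ [∇⨾Δ]₁₂ [∇⨾Δ]₂₁ [∇⨾Δ]₂₂)
             ○≤ +-lub ≤-refl (≈⇒≤ (idˡ ○ idʳ) ○≤ id*≤id)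

  kleeneBicategoryTrace : KleeneBicategoryTrace 𝔅
  kleeneBicategoryTrace = record
    { tr         = conway
    ; tr-cong    = conway-cong
    ; tightening = conway-tightening
    ; strength   = conway-strength
    ; joining    = conway-joining
    ; vanishing  = conway-vanishing
    ; sliding    = conway-sliding
    ; yanking    = conway-yanking
    ; AU1        = conway-AU1
    ; AU2        = conway-AU2
    ; AT1        = conway-AT1
    }

module TraceToStar {o ℓ e r} {𝒞 : SymMonPosCat o ℓ e r} {𝔅 : FinBiprodIdemConv 𝒞} (TR : KleeneBicategoryTrace 𝔅) where
  open Matrices 𝔅
  open KleeneBicategoryTrace TR

  private variable
    A B S T X Y : Obj

  star : A ⇒ A → A ⇒ A
  star a = tr (mat a id id 0ₕ)

  star-cong : {a a′ : A ⇒ A} → a ≈ a′ → star a ≈ star a′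
  star-cong p = tr-cong (mat-cong p refl≈ refl≈ refl≈)

  open Conway star star-cong

  tr-+-0⊕ : {K : S ⊕ X ⇒ S ⊕ Y} {d : X ⇒ Y} → tr (K + 0ₕ ⊕₁ d) ≈ tr K + d
  tr-+-0⊕ {K = K} {d} = begin-equality
    tr (K + 0ₕ ⊕₁ d)                                                   ≈⟨ tr-cong wired ⟩
    tr ((id ⊕₁ Δ) ⨾ (α⇐ ⨾ (K ⊕₁ id) ⨾ α⇒) ⨾ (id ⊕₁ ((id ⊕₁ d) ⨾ ∇))) ≈⟨ tightening ⟩
    Δ ⨾ tr (α⇐ ⨾ (K ⊕₁ id) ⨾ α⇒) ⨾ (id ⊕₁ d) ⨾ ∇                       ≈⟨ refl⟩⨾⟨ strength ⟩⨾⟨refl ⟩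
    Δ ⨾ (tr K ⊕₁ id) ⨾ (id ⊕₁ d) ⨾ ∇                                   ≈⟨ refl⟩⨾⟨ pullˡ ⊕-homo′ ⟩
    Δ ⨾ ((tr K ⨾ id) ⊕₁ (id ⨾ d)) ⨾ ∇                                  ≈⟨ refl⟩⨾⟨ (idʳ ⟩⊕⟨ idˡ) ⟩⨾⟨refl ⟩
    tr K + d                                                           ∎
    where
    wired : K + 0ₕ ⊕₁ d ≈ (id ⊕₁ Δ) ⨾ (α⇐ ⨾ (K ⊕₁ id) ⨾ α⇒) ⨾ (id ⊕₁ ((id ⊕₁ d) ⨾ ∇))
    wired = entrywise
      (⨾-distrib-+ ○ refl⟩+⟨ [⊕]₁₁ ○ +-identityʳ
        ○ sym≈ ([⊕⨾-⨾⊕]₁₁ ○ idˡ ○ idʳ ○ [α⇐⨾-⊕id⨾α⇒]₁₁))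
      (⨾-distrib-+ ○ refl⟩+⟨ [⊕]₁₂ ○ +-identityʳ
        ○ sym≈ ([⊕⨾-⨾⊕]₁₂ ○ idˡ ○ [α⇐⨾-⊕id⨾α⇒]₁₂ ⟩⨾⟨refl ○ assoc
                ○ refl⟩⨾⟨ (pullˡ ι₁-natural ○ assoc ○ idˡ ○ ι₁⨾∇) ○ idʳ))
      (⨾-distrib-+ ○ refl⟩+⟨ [⊕]₂₁ ○ +-identityʳ
        ○ sym≈ ([⊕⨾-⨾⊕]₂₁ ○ refl⟩⨾⟨ (idʳ ○ [α⇐⨾-⊕id⨾α⇒]₂₁) ○ sym-assoc ○ elimˡ Δ⨾π₁))
      (⨾-distrib-+ ○ refl⟩+⟨ [⊕]₂₂
        ○ sym≈ ([⊕⨾-⨾⊕]₂₂ ○ refl⟩⨾⟨ (pullˡ ([α⇐⨾-⊕id⨾α⇒]₂₂ ⟩⨾⟨refl ○ ⊕-homo′) ○ (idʳ ⟩⊕⟨ idˡ) ⟩⨾⟨refl)))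

  tr-mat-zero : {a : S ⇒ S} {b : S ⇒ Y} {c : X ⇒ S} → tr (mat a b c 0ₕ) ≈ c ⨾ star a ⨾ b
  tr-mat-zero = tr-cong (entrywise
    ([mat]₁₁ ○ sym≈ ([⊕⨾-⨾⊕]₁₁ ○ idˡ ○ [mat]₁₁ ⟩⨾⟨refl ○ idʳ))
    ([mat]₁₂ ○ sym≈ ([⊕⨾-⨾⊕]₁₂ ○ idˡ ○ [mat]₁₂ ⟩⨾⟨refl ○ idˡ))
    ([mat]₂₁ ○ sym≈ ([⊕⨾-⨾⊕]₂₁ ○ refl⟩⨾⟨ ([mat]₂₁ ⟩⨾⟨refl ○ idʳ) ○ idʳ))
    ([mat]₂₂ ○ sym≈ ([⊕⨾-⨾⊕]₂₂ ○ refl⟩⨾⟨ ([mat]₂₂ ⟩⨾⟨refl ○ zeroˡ) ○ zeroʳ)))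
    ○ tightening

  tr-formula : {K : S ⊕ X ⇒ S ⊕ Y} → tr K ≈ conway K
  tr-formula {K = K} = tr-cong split-off-corner ○ tr-+-0⊕ ○ tr-mat-zero ⟩+⟨refl ○ +-comm
    where
    split-off-corner : K ≈ mat [ K ]₁₁ [ K ]₁₂ [ K ]₂₁ 0ₕ + 0ₕ ⊕₁ [ K ]₂₂
    split-off-corner = entrywise
      (sym≈ (⨾-distrib-+ ○ [mat]₁₁ ⟩+⟨ [⊕]₁₁ ○ +-identityʳ))
      (sym≈ (⨾-distrib-+ ○ [mat]₁₂ ⟩+⟨ [⊕]₁₂ ○ +-identityʳ))
      (sym≈ (⨾-distrib-+ ○ [mat]₂₁ ⟩+⟨ [⊕]₂₁ ○ +-identityʳ))
      (sym≈ (⨾-distrib-+ ○ [mat]₂₂ ⟩+⟨ [⊕]₂₂ ○ +-identityˡ))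

  tr-mat : {a : S ⇒ S} {b : S ⇒ Y} {c : X ⇒ S} {d : X ⇒ Y} → tr (mat a b c d) ≈ d + c ⨾ star a ⨾ b
  tr-mat = tr-formula ○ conway-by [mat]₁₁ [mat]₁₂ [mat]₂₁ [mat]₂₂

  star-slide : {f : A ⇒ B} {g : B ⇒ A} → g ⨾ star (f ⨾ g) ≈ star (g ⨾ f) ⨾ g
  star-slide {f = f} {g} = begin-equality
    g ⨾ star (f ⨾ g)                  ≈⟨ sym≈ (+-identityˡ ○ idˡ ⟩⨾⟨ idʳ) ⟩
    0ₕ + (id ⨾ g) ⨾ star (f ⨾ g) ⨾ id  ≈⟨ sym≈ (tr-formula ○ conway-by
                                            ([-⨾⊕]₁₁ ○ [mat]₁₁ ⟩⨾⟨refl) ([-⨾⊕]₁₂ ○ [mat]₁₂ ⟩⨾⟨refl ○ idʳ)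
                                            ([-⨾⊕]₂₁ ○ [mat]₂₁ ⟩⨾⟨refl) ([-⨾⊕]₂₂ ○ [mat]₂₂ ⟩⨾⟨refl ○ idʳ)) ⟩
    tr (mat f id id 0ₕ ⨾ (g ⊕₁ id))    ≈⟨ sliding ⟩
    tr ((g ⊕₁ id) ⨾ mat f id id 0ₕ)    ≈⟨ tr-formula ○ conway-by
                                            ([⊕⨾-]₁₁ ○ refl⟩⨾⟨ [mat]₁₁) ([⊕⨾-]₁₂ ○ refl⟩⨾⟨ [mat]₁₂)
                                            ([⊕⨾-]₂₁ ○ idˡ ○ [mat]₂₁) ([⊕⨾-]₂₂ ○ idˡ ○ [mat]₂₂) ⟩
    0ₕ + id ⨾ star (g ⨾ f) ⨾ (g ⨾ id)  ≈⟨ +-identityˡ ○ idˡ ○ refl⟩⨾⟨ idʳ ⟩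
    star (g ⨾ f) ⨾ g                  ∎

  star-zero : star 0ₕ ≈ id {A}
  star-zero = tr-cong (entrywise ([mat]₁₁ ○ sym≈ [σ]₁₁) ([mat]₁₂ ○ sym≈ [σ]₁₂)
                                 ([mat]₂₁ ○ sym≈ [σ]₂₁) ([mat]₂₂ ○ sym≈ [σ]₂₂))
            ○ yanking

  star-id≤id : star id ≤ id {A}
  star-id≤id = ≈⇒≥ (idˡ ○ idʳ) ○≤ y≤x+y
             ○≤ ≈⇒≥ (tr-formula ○ conway-by [∇⨾Δ]₁₁ [∇⨾Δ]₁₂ [∇⨾Δ]₂₁ [∇⨾Δ]₂₂) ○≤ AT1

  star-blockStar : {M : S ⊕ T ⇒ S ⊕ T} → star M ≈ blockStar M
  star-blockStar = joining ○ tr-formula ○ conway-cong tr-formula ○ conway-nested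
                 ○ [mat]₂₂ ⟩+⟨ [mat]₂₁ ⟩⨾⟨ blockStar-cong [mat]₁₁ ⟩⨾⟨ [mat]₁₂ ○ +-identityˡ ○ idˡ ○ idʳ

  star-σ-conjugate : {M : S ⊕ S ⇒ S ⊕ S} → star (σ ⨾ M ⨾ σ) ≈ σ ⨾ star M ⨾ σ
  star-σ-conjugate = introʳ symmetry ○ sym-assoc ○ sym≈ star-slide ⟩⨾⟨refl
                   ○ (refl⟩⨾⟨ star-cong (assoc ○ elimʳ symmetry)) ⟩⨾⟨refl ○ assoc

  -- The corner [ star N ]₁₁ is id + star x ⨾ x by the block formula, and it is star x by the same
  -- formula applied after exchanging the two summands with σ.
  star-unfold : ∀ {A} {x : A ⇒ A} → star x ≈ id + star x ⨾ x
  star-unfold {A} {x} = begin-equality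
    star x                      ≈⟨ star-cong (sym≈ conway-σ⨾N⨾σ) ○ sym≈ [blockStar]₂₂ ⟩
    [ blockStar (σ ⨾ N ⨾ σ) ]₂₂ ≈⟨ inner-cong (sym≈ star-blockStar ○ star-σ-conjugate) ○ [σ⨾-⨾σ]₂₂ ⟩
    [ star N ]₁₁                ≈⟨ inner-cong star-blockStar ○ [blockStar]₁₁ ⟩
    star [ N ]₁₁ + star [ N ]₁₁ ⨾ [ N ]₁₂ ⨾ star (conway N) ⨾ [ N ]₂₁ ⨾ star [ N ]₁₁
      ≈⟨ star0 ⟩+⟨ star0 ⟩⨾⟨ [mat]₁₂ ⟩⨾⟨ star-cong conway-N ⟩⨾⟨ [mat]₂₁ ⟩⨾⟨ star0 ⟩
    id + id ⨾ id ⨾ star x ⨾ x ⨾ id ≈⟨ refl⟩+⟨ (idˡ ○ idˡ ○ refl⟩⨾⟨ idʳ) ⟩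
    id + star x ⨾ x             ∎
    where
    N : A ⊕ A ⇒ A ⊕ A
    N = mat 0ₕ id x 0ₕ
    star0 : star [ N ]₁₁ ≈ id
    star0 = star-cong [mat]₁₁ ○ star-zero
    conway-N : conway N ≈ x
    conway-N = conway-by [mat]₁₁ [mat]₁₂ [mat]₂₁ [mat]₂₂ ○ +-identityˡ ○ refl⟩⨾⟨ (idʳ ○ star-zero) ○ idʳ
    conway-σ⨾N⨾σ : conway (σ ⨾ N ⨾ σ) ≈ x
    conway-σ⨾N⨾σ = conway-by ([σ⨾-⨾σ]₁₁ ○ [mat]₂₂) ([σ⨾-⨾σ]₁₂ ○ [mat]₂₁) ([σ⨾-⨾σ]₂₁ ○ [mat]₁₂) ([σ⨾-⨾σ]₂₂ ○ [mat]₁₁)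
                 ○ +-identityˡ ○ idˡ ○ star-zero ⟩⨾⟨refl ○ idˡ

  star-induction : {f : A ⇒ A} {r : A ⇒ B} → f ⨾ r ≤ r → star f ⨾ r ≤ r
  star-induction {f = f} {r} p = begin
    star f ⨾ r           ≈⟨ sym≈ (tr-mat ○ +-identityˡ ○ idˡ) ⟩
    tr (mat f r id 0ₕ)   ≤⟨ AU1 r simulation ⟩
    tr (mat id id r 0ₕ)  ≈⟨ tr-mat ○ +-identityˡ ○ refl⟩⨾⟨ idʳ ⟩
    r ⨾ star id          ≤⟨ ⨾-monoʳ star-id≤id ⟩
    r ⨾ id               ≈⟨ idʳ ⟩
    r                    ∎
    where
    simulation : mat f r id 0ₕ ⨾ (r ⊕₁ id) ≤ (r ⊕₁ id) ⨾ mat id id r 0ₕ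
    simulation = entrywise-≤
      (≈⇒≤ ([-⨾⊕]₁₁ ○ [mat]₁₁ ⟩⨾⟨refl) ○≤ p ○≤ ≈⇒≥ ([⊕⨾-]₁₁ ○ refl⟩⨾⟨ [mat]₁₁ ○ idʳ))
      (≈⇒≤ ([-⨾⊕]₁₂ ○ [mat]₁₂ ⟩⨾⟨refl ○ sym≈ ([⊕⨾-]₁₂ ○ refl⟩⨾⟨ [mat]₁₂)))
      (≈⇒≤ ([-⨾⊕]₂₁ ○ [mat]₂₁ ⟩⨾⟨refl ○ sym≈ ([⊕⨾-]₂₁ ○ refl⟩⨾⟨ [mat]₂₁)))
      (≈⇒≤ ([-⨾⊕]₂₂ ○ [mat]₂₂ ⟩⨾⟨refl ○ zeroˡ ○ sym≈ ([⊕⨾-]₂₂ ○ refl⟩⨾⟨ [mat]₂₂ ○ idˡ)))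

  star-inductionʳ : {f : A ⇒ A} {l : B ⇒ A} → l ⨾ f ≤ l → l ⨾ star f ≤ l
  star-inductionʳ {f = f} {l} p = begin
    l ⨾ star f           ≈⟨ sym≈ (tr-mat ○ +-identityˡ ○ refl⟩⨾⟨ idʳ) ⟩
    tr (mat f id l 0ₕ)   ≤⟨ AU2 l simulation ⟩
    tr (mat id l id 0ₕ)  ≈⟨ tr-mat ○ +-identityˡ ○ idˡ ⟩
    star id ⨾ l          ≤⟨ ⨾-monoˡ star-id≤id ⟩
    id ⨾ l               ≈⟨ idˡ ⟩
    l                    ∎
    where
    simulation : (l ⊕₁ id) ⨾ mat f id l 0ₕ ≤ mat id l id 0ₕ ⨾ (l ⊕₁ id)
    simulation = entrywise-≤
      (≈⇒≤ ([⊕⨾-]₁₁ ○ refl⟩⨾⟨ [mat]₁₁) ○≤ p ○≤ ≈⇒≥ ([-⨾⊕]₁₁ ○ [mat]₁₁ ⟩⨾⟨refl ○ idˡ))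
      (≈⇒≤ ([⊕⨾-]₁₂ ○ refl⟩⨾⟨ [mat]₁₂ ○ sym≈ ([-⨾⊕]₁₂ ○ [mat]₁₂ ⟩⨾⟨refl)))
      (≈⇒≤ ([⊕⨾-]₂₁ ○ refl⟩⨾⟨ [mat]₂₁ ○ sym≈ ([-⨾⊕]₂₁ ○ [mat]₂₁ ⟩⨾⟨refl)))
      (≈⇒≤ ([⊕⨾-]₂₂ ○ refl⟩⨾⟨ [mat]₂₂ ○ idˡ ○ sym≈ ([-⨾⊕]₂₂ ○ [mat]₂₂ ⟩⨾⟨refl ○ zeroˡ)))

  kleeneStar : KleeneStar 𝔅
  kleeneStar = record
    { _*           = star
    ; star-unfoldˡ = ≈⇒≤ (refl⟩+⟨ star-slide′ ○ sym≈ star-unfold)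
    ; star-unfoldʳ = ≈⇒≥ star-unfold
    ; star-indʳ    = star-induction
    ; star-indˡ    = star-inductionʳ
    }
    where
    star-slide′ : {x : A ⇒ A} → x ⨾ star x ≈ star x ⨾ x
    star-slide′ = refl⟩⨾⟨ star-cong (sym≈ idˡ) ○ star-slide ○ star-cong idʳ ⟩⨾⟨refl

proposition6p7 : ∀ {o ℓ e r : Level} (𝒞 : SymMonPosCat o ℓ e r) (B : FinBiprodIdemConv 𝒞) →
    KleeneBicategoryTrace B ⇔ KleeneStar B
proposition6p7 𝒞 B = mk⇔ TraceToStar.kleeneStar StarToTrace.kleeneBicategoryTrace
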